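{- Let $\Delta\ge1$, $\lambda>0$, $s\ge 2$, and let $(G=(V,E),\mathcal L)$ be an instance with $G$ of maximum degree $\le\Delta$, $|E|\le s$, $|\mathcal L(e)|\ge\deg(e)+\lambda\Delta+1$ for all $e\in E$; let $i=\{u,v\}\in E$ with $\deg(u)=1$ and $\deg(v)\ge2$, let $a\ne b$ be colors in $\mathcal L(i)$, let $N=E(v)\setminus\{i\}$, and let $j\in N$ with $a,b\in\mathcal L(j)$. Then (1) $\mathcal W_1\big(\mu^{i\leftarrow a,\,j\leftarrow b}_{E-i},\mu^{i\leftarrow b,\,j\leftarrow a}_{E-i}\big)\le 1+\kappa_{s-1,\Delta,\lambda}$; (2) $\mathcal W_1\big(\mu^{i\leftarrow a,\,j\leftarrow b}_{E-i},\mu^{i\leftarrow b}_{E-i}\big)\le 1+2\kappa_{s-1,\Delta,\lambda}$ and $\mathcal W_1\big(\mu^{i\leftarrow b,\,j\leftarrow a}_{E-i},\mu^{i\leftarrow a}_{E-i}\big)\le 1+2\kappa_{s-1,\Delta,\lambda}$; (3) $\mathcal W_1\big(\mu^{i\leftarrow a,\,b\notin N}_{E-i},\mu^{i\leftarrow b,\,a\notin N}_{E-i}\big)=0$.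
   Context: A list edge coloring instance $(G,\mathcal L)$: $G=(V,E)$ finite undirected graph, lists $\mathcal L(e)\subseteq[q]$; $\deg(e)$ is the number of edges other than $e$ sharing an endpoint with $e$; $\deg(v)$ is the vertex degree and $E(v)$ the set of edges incident to $v$; proper edge colorings are $\sigma:E\to[q]$ with $\sigma(e)\in\mathcal L(e)$ and distinct colors on distinct edges sharing an endpoint; $\mu$ is the uniform distribution on proper edge colorings. $\mu^{i\leftarrow a,\,j\leftarrow b}_{E-i}$ is the marginal on $E\setminus\{i\}$ of $\mu$ conditioned on $i$ colored $a$ and $j$ colored $b$; $\mu^{i\leftarrow a,\,b\notin N}_{E-i}$ is the marginal on $E\setminus\{i\}$ of $\mu$ conditioned on $i$ colored $a$ and no edge of $N$ colored $b$; similarly for the others. $\mathcal W_1$ is the Wasserstein-1 distance with respect to Hamming distance. An edge is pendant if one of its endpoints has degree $1$. For $s\ge1$, $\kappa_{s,\Delta,\lambda}$ is the supremum of $\mathcal W_1(\mu^{i\leftarrow a}_{E-i},\mu^{i\leftarrow b}_{E-i})$ over all instances with maximum degree $\le\Delta$, at most $s$ edges, and $|\mathcal L(e)|\ge\deg(e)+\lambda\Delta+1$ for all edges $e$, over all pendant edges $i$, and all distinct $a,b\in\mathcal L(i)$.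
   Formalization: The parameter λ ranges over the positive rationals, so the constant $\kappa_{s-1,\Delta,\lambda}$ is likewise taken at rational λ. -}

module Defs where

open import Data.Nat as ℕ using (ℕ; zero; suc; _≤_)
open import Data.Fin using (Fin; _≟_)
open import Data.Fin.Properties using (all?)
open import Data.Fin.Subset using (Subset; _∈_; ∣_∣)
open import Data.Fin.Subset.Properties using (_∈?_)
open import Data.Vec as Vec using (Vec; []; _∷_; lookup; removeAt)
import Data.Vec.Properties as VecP
open import Data.List as List using (List; length; filter; map; concatMap; allFin; foldr)
open import Data.Integer using (+_)
open import Data.Rational as ℚ using (ℚ; 0ℚ; 1ℚ; _/_)
open import Data.Product using (Σ; _×_; _,_; proj₁; proj₂)
open import Data.Sum using (_⊎_)
open import Relation.Nullary using (¬_; Dec; yes; no)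
open import Relation.Nullary.Decidable using (_×-dec_; _⊎-dec_; ¬?; _→-dec_)
open import Relation.Unary using (Pred; Decidable)
import Agda.Primitive
open import Relation.Binary.PropositionalEquality using (_≡_; _≢_)

record Graph : Set where
  field
    nV nE    : ℕ
    ends     : Fin nE → Fin nV × Fin nV
    loopless : ∀ e → proj₁ (ends e) ≢ proj₂ (ends e)

  Inc : Fin nE → Fin nV → Set
  Inc e x = (x ≡ proj₁ (ends e)) ⊎ (x ≡ proj₂ (ends e))

  Inc? : ∀ e x → Dec (Inc e x)
  Inc? e x = (x ≟ proj₁ (ends e)) ⊎-dec (x ≟ proj₂ (ends e))

  field
    simple : ∀ e f → Inc e (proj₁ (ends f)) → Inc e (proj₂ (ends f)) → e ≡ f

  Adj : Fin nE → Fin nE → Set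
  Adj e f = (e ≢ f) × (Inc f (proj₁ (ends e)) ⊎ Inc f (proj₂ (ends e)))

  Adj? : ∀ e f → Dec (Adj e f)
  Adj? e f = ¬? (e ≟ f) ×-dec (Inc? f (proj₁ (ends e)) ⊎-dec Inc? f (proj₂ (ends e)))

  vdeg : Fin nV → ℕ
  vdeg x = length (filter (λ e → Inc? e x) (allFin nE))

  edeg : Fin nE → ℕ
  edeg e = length (filter (λ f → Adj? e f) (allFin nE))

  MaxDegLe : ℕ → Set
  MaxDegLe Δ = ∀ x → vdeg x ≤ Δ

  Pendant : Fin nE → Set
  Pendant e = (vdeg (proj₁ (ends e)) ≡ 1) ⊎ (vdeg (proj₂ (ends e)) ≡ 1)

record Instance : Set where
  field
    G : Graph
    q : ℕ
  open Graph G public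
  field
    L : Fin nE → Subset q

  Colouring : Set
  Colouring = Vec (Fin q) nE

  Proper : Colouring → Set
  Proper σ = (∀ e → lookup σ e ∈ L e)
           × (∀ e f → Adj e f → lookup σ e ≢ lookup σ f)

  Proper? : ∀ σ → Dec (Proper σ)
  Proper? σ = all? (λ e → lookup σ e ∈? L e)
        ×-dec all? (λ e → all? (λ f → Adj? e f →-dec ¬? (lookup σ e ≟ lookup σ f)))

allVecs : (q k : ℕ) → List (Vec (Fin q) k)
allVecs q zero    = [] List.∷ List.[]
allVecs q (suc k) = concatMap (λ c → map (c ∷_) (allVecs q k)) (allFin q)

⟦_⟧ : ℕ → ℚ
⟦ n ⟧ = (+ n) / 1

-- c / t as a rational (0 if t = 0)
ratio : ℕ → ℕ → ℚ
ratio c zero    = 0ℚ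
ratio c (suc t) = (+ c) / suc t

sumℚ : List ℚ → ℚ
sumℚ = foldr ℚ._+_ 0ℚ

ham : ∀ {q k} → Vec (Fin q) k → Vec (Fin q) k → ℕ
ham []       []       = 0
ham (x ∷ xs) (y ∷ ys) with x ≟ y
... | yes _ = ham xs ys
... | no  _ = suc (ham xs ys)

-- restriction of a colouring of E to E - i (deleting coordinate i)
dropAt : ∀ {A : Set} {n} → Vec A n → Fin n → Vec A (ℕ.pred n)
dropAt {n = suc n} v i = removeAt v i

-- Finite distributions on Vec (Fin q) k given by their probability mass
-- function, and the Wasserstein-1 distance w.r.t. Hamming distance:
-- W1(μ,ν) ≤ r  iff  there is a coupling π of μ and ν with E_π[ham] ≤ r.
-- (On a finite space the infimum over couplings is attained, and for
-- rational data by a rational coupling.)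

W1≤ : ∀ {q k} → (Vec (Fin q) k → ℚ) → (Vec (Fin q) k → ℚ) → ℚ → Set
W1≤ {q} {k} μ ν r =
  Σ (Vec (Fin q) k → Vec (Fin q) k → ℚ) λ π →
      (∀ x y → 0ℚ ℚ.≤ π x y)
    × (∀ x → sumℚ (map (λ y → π x y) (allVecs q k)) ≡ μ x)
    × (∀ y → sumℚ (map (λ x → π x y) (allVecs q k)) ≡ ν y)
    × (sumℚ (concatMap (λ x → map (λ y → π x y ℚ.* ⟦ ham x y ⟧) (allVecs q k))
                       (allVecs q k)) ℚ.≤ r)

module _ (I : Instance) where
  open Instance I

  -- μ^{C}_{E-i}: marginal on E - i of the uniform distribution on proper
  -- colourings conditioned on the (decidable) event C.
  condMarg : {C : Pred Colouring Agda.Primitive.lzero} → Decidable C → Fin nE →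
             Vec (Fin q) (ℕ.pred nE) → ℚ
  condMarg C? i τ =
    let S = filter (λ σ → Proper? σ ×-dec C? σ) (allVecs q nE)
    in ratio (length (filter (λ σ → VecP.≡-dec _≟_ (dropAt σ i) τ) S)) (length S)

  Fix : Fin nE → Fin q → Colouring → Set
  Fix e c σ = lookup σ e ≡ c

  Fix? : ∀ e c σ → Dec (Fix e c σ)
  Fix? e c σ = lookup σ e ≟ c

  Fix2 : Fin nE → Fin q → Fin nE → Fin q → Colouring → Set
  Fix2 i a j b σ = Fix i a σ × Fix j b σ

  Fix2? : ∀ i a j b σ → Dec (Fix2 i a j b σ)
  Fix2? i a j b σ = Fix? i a σ ×-dec Fix? j b σ

  FixAvoid : Fin nE → Fin q → Fin nV → Fin q → Colouring → Set
  FixAvoid i a v b σ = Fix i a σ × (∀ e → Inc e v → e ≢ i → lookup σ e ≢ b)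

  FixAvoid? : ∀ i a v b σ → Dec (FixAvoid i a v b σ)
  FixAvoid? i a v b σ = Fix? i a σ ×-dec
    all? (λ e → Inc? e v →-dec (¬? (e ≟ i) →-dec ¬? (lookup σ e ≟ b)))

  ListCond : ℚ → ℕ → Set
  ListCond λ' Δ = ∀ e → ⟦ edeg e ⟧ ℚ.+ λ' ℚ.* ⟦ Δ ⟧ ℚ.+ 1ℚ ℚ.≤ ⟦ ∣ L e ∣ ⟧

-- K is an upper bound for κ_{s,Δ,λ}
KappaBound : ℕ → ℕ → ℚ → ℚ → Set
KappaBound s Δ λ' K =
  (I : Instance) → let open Instance I in
  nE ≤ s → MaxDegLe Δ → ListCond I λ' Δ →
  (i : Fin nE) → Pendant i → (a b : Fin q) → a ∈ L i → b ∈ L i → a ≢ b →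
  W1≤ (condMarg I (Fix? I i a) i) (condMarg I (Fix? I i b) i) K

module Submission where

-- Since u has degree 1, fixing the colour of i = uv only constrains the edges at v, and the laws
-- compared are laws of the colourings of the remaining edges.
--
-- (3) Recolouring i from a to b is a bijection between the colourings with i ← a avoiding b on N
-- and those with i ← b avoiding a on N, so the two laws coincide.
--
-- (1) With i ← x and j ← y fixed, the other edges see exactly the constraints of a smaller
-- instance: delete i and j, add a pendant edge uw (w the other end of j) with list L(j), and
-- remove x and y from the lists of the remaining edges at v. Colouring the new edge y or x
-- recovers i ← x, j ← y or i ← y, j ← x, so κ for this instance (fewer edges, and the list
-- condition survives because no edge loses more colours than neighbours) couples the rest at
-- cost κ, and j adds 1.
--
-- (2) Decompose μ^{i←b} by the colour c of j and use convexity of W₁. For c = a this is (1);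
-- otherwise pass through μ^{i←c, j←b}, where only the colour of i changes (a reduction as in (1),
-- with j deleted and its neighbours losing b, costs κ), and then apply (1) to reach μ^{i←b, j←c}.

open import Defs
open import Data.Nat as ℕ using (ℕ; zero; suc; _∸_; z≤n; s≤s)
import Data.Nat.Properties as ℕP
import Algebra.Properties.CommutativeSemigroup ℕP.+-commutativeSemigroup as ℕ-+
open import Data.Nat.Coprimality using (1-coprimeTo) renaming (sym to coprime-sym)
import Data.Integer as ℤ
import Data.Integer.Properties as ℤP
open import Data.Rational as ℚ using (ℚ; 0ℚ; 1ℚ; mkℚ; _+_; _*_)
import Data.Rational.Properties as ℚP
open import Data.Rational.Solver using (module +-*-Solver)
open import Data.Fin using (Fin; zero; suc; punchIn; punchOut; _≟_)
import Data.Fin.Properties as FP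
open import Data.Fin.Subset as S using (Subset; inside; outside; _∈_; _-_; ∣_∣)
import Data.Fin.Subset.Properties as SP
open import Data.Vec using (Vec; []; _∷_; lookup; insertAt; removeAt; here; there)
import Data.Vec.Properties as VecP
import Data.List.Properties
open import Data.List as List using (List; []; _∷_; map; concatMap; allFin; _++_; filter; length)
open import Data.List.Membership.Propositional using () renaming (_∈_ to _∈ˡ_)
open import Data.List.Membership.Propositional.Properties using (∈-allFin; ∈-map⁺; ∈-++⁺ˡ; ∈-++⁺ʳ)
open import Data.List.Relation.Unary.Any using (here; there)
open import Data.Empty using (⊥; ⊥-elim)
open import Data.Sum using (_⊎_; inj₁; inj₂)
open import Data.Product using (Σ; _×_; _,_; proj₁; proj₂)
open import Function using (_∘_)
open import Relation.Binary.PropositionalEquality using (_≡_; _≢_; refl; sym; trans; cong; cong₂; subst; subst₂; module ≡-Reasoning)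
open import Relation.Binary.Definitions using (tri<; tri≈; tri>)
open import Relation.Nullary using (Dec; yes; no; ¬_)
open import Relation.Nullary.Decidable using (_×-dec_; _⊎-dec_)

module Counting where
  open import Data.Nat using (_≤_)

  𝟙 : ∀ {P : Set} → Dec P → ℕ
  𝟙 (yes _) = 1
  𝟙 (no _)  = 0

  module _ {P : Set} where

    𝟙-yes : ∀ (d : Dec P) → P → 𝟙 d ≡ 1
    𝟙-yes (yes _) _ = refl
    𝟙-yes (no ¬p) p = ⊥-elim (¬p p)

    𝟙-no : ∀ (d : Dec P) → ¬ P → 𝟙 d ≡ 0
    𝟙-no (yes p) ¬p = ⊥-elim (¬p p)
    𝟙-no (no _)  _  = refl

    𝟙-mono : ∀ {Q : Set} (d : Dec P) (e : Dec Q) → (P → Q) → 𝟙 d ≤ 𝟙 e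
    𝟙-mono (yes p) (yes _) P⇒Q = ℕP.≤-refl
    𝟙-mono (yes p) (no ¬q) P⇒Q = ⊥-elim (¬q (P⇒Q p))
    𝟙-mono (no _)  e       P⇒Q = z≤n

  𝟙-⊎ : ∀ {P Q R : Set} (d : Dec P) (e : Dec Q) (f : Dec R) → (P → Q ⊎ R) → 𝟙 d ≤ 𝟙 e ℕ.+ 𝟙 f
  𝟙-⊎ (no _)  e f P⇒Q⊎R = z≤n
  𝟙-⊎ (yes p) e f P⇒Q⊎R with P⇒Q⊎R p
  ... | inj₁ q rewrite 𝟙-yes e q = s≤s z≤n
  ... | inj₂ r rewrite 𝟙-yes f r = ℕP.m≤n+m 1 (𝟙 e)

  count : ∀ {n} {P : Fin n → Set} → (∀ k → Dec (P k)) → ℕ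
  count {zero}  P? = 0
  count {suc n} P? = 𝟙 (P? zero) ℕ.+ count (P? ∘ suc)

  length-filter-tabulate : ∀ {A : Set} {P : A → Set} (P? : ∀ x → Dec (P x)) n (f : Fin n → A) →
                           length (filter P? (List.tabulate f)) ≡ count (P? ∘ f)
  length-filter-tabulate P? zero    f = refl
  length-filter-tabulate P? (suc n) f with P? (f zero)
  ... | yes _ = cong suc (length-filter-tabulate P? n (f ∘ suc))
  ... | no _  = length-filter-tabulate P? n (f ∘ suc)

  count-punchIn : ∀ {n} {P : Fin (suc n) → Set} (P? : ∀ k → Dec (P k)) (p : Fin (suc n)) →
                  count P? ≡ 𝟙 (P? p) ℕ.+ count (P? ∘ punchIn p)
  count-punchIn         P? zero    = refl
  count-punchIn {suc n} P? (suc p) = begin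
      𝟙 (P? zero) ℕ.+ count (P? ∘ suc)
    ≡⟨ cong (𝟙 (P? zero) ℕ.+_) (count-punchIn (P? ∘ suc) p) ⟩
      𝟙 (P? zero) ℕ.+ (𝟙 (P? (suc p)) ℕ.+ count (P? ∘ suc ∘ punchIn p))
    ≡⟨ ℕ-+.x∙yz≈y∙xz (𝟙 (P? zero)) (𝟙 (P? (suc p))) _ ⟩
      𝟙 (P? (suc p)) ℕ.+ (𝟙 (P? zero) ℕ.+ count (P? ∘ suc ∘ punchIn p))
    ∎
    where open ≡-Reasoning

  count-mono : ∀ {n} {P Q : Fin n → Set} (P? : ∀ k → Dec (P k)) (Q? : ∀ k → Dec (Q k)) →
               (∀ k → P k → Q k) → count P? ≤ count Q?
  count-mono {zero}  P? Q? P⇒Q = z≤n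
  count-mono {suc n} P? Q? P⇒Q =
    ℕP.+-mono-≤ (𝟙-mono (P? zero) (Q? zero) (P⇒Q zero)) (count-mono (P? ∘ suc) (Q? ∘ suc) (P⇒Q ∘ suc))

  count-cong : ∀ {n} {P Q : Fin n → Set} (P? : ∀ k → Dec (P k)) (Q? : ∀ k → Dec (Q k)) →
               (∀ k → P k → Q k) → (∀ k → Q k → P k) → count P? ≡ count Q?
  count-cong P? Q? P⇒Q Q⇒P = ℕP.≤-antisym (count-mono P? Q? P⇒Q) (count-mono Q? P? Q⇒P)

  count-none : ∀ {n} {P : Fin n → Set} (P? : ∀ k → Dec (P k)) → (∀ k → ¬ P k) → count P? ≡ 0
  count-none {zero}  P? ¬P = refl
  count-none {suc n} P? ¬P = cong₂ ℕ._+_ (𝟙-no (P? zero) (¬P zero)) (count-none (P? ∘ suc) (¬P ∘ suc))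

  1≤count : ∀ {n} {P : Fin n → Set} (P? : ∀ k → Dec (P k)) k → P k → 1 ≤ count P?
  1≤count {suc n} P? zero    p rewrite 𝟙-yes (P? zero) p = s≤s z≤n
  1≤count {suc n} P? (suc k) p = ℕP.≤-trans (1≤count (P? ∘ suc) k p) (ℕP.m≤n+m _ (𝟙 (P? zero)))

  2≤count : ∀ {n} {P : Fin n → Set} (P? : ∀ k → Dec (P k)) {e f} → e ≢ f → P e → P f → 2 ≤ count P?
  2≤count {suc n} P? {zero}  {zero}  e≢f _  _  = ⊥-elim (e≢f refl)
  2≤count {suc n} P? {zero}  {suc f} _   Pe Pf rewrite 𝟙-yes (P? zero) Pe = s≤s (1≤count (P? ∘ suc) f Pf)
  2≤count {suc n} P? {suc e} {zero}  _   Pe Pf rewrite 𝟙-yes (P? zero) Pf = s≤s (1≤count (P? ∘ suc) e Pe)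
  2≤count {suc n} P? {suc e} {suc f} e≢f Pe Pf =
    ℕP.≤-trans (2≤count (P? ∘ suc) (e≢f ∘ cong suc) Pe Pf) (ℕP.m≤n+m _ (𝟙 (P? zero)))

  exchange-≤ : ∀ {a e l ℓ} r → r ℕ.+ a ≤ e → l ≤ r ℕ.+ ℓ → a ℕ.+ l ≤ e ℕ.+ ℓ
  exchange-≤ {a} {e} {l} {ℓ} r r+a≤e l≤r+ℓ = begin
      a ℕ.+ l
    ≤⟨ ℕP.+-monoʳ-≤ a l≤r+ℓ ⟩
      a ℕ.+ (r ℕ.+ ℓ)
    ≡⟨ ℕ-+.x∙yz≈yx∙z a r ℓ ⟩
      r ℕ.+ a ℕ.+ ℓ
    ≤⟨ ℕP.+-monoˡ-≤ ℓ r+a≤e ⟩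
      e ℕ.+ ℓ
    ∎
    where open ℕP.≤-Reasoning

  ∣p∣≤1+∣p-x∣ : ∀ {n} (p : Subset n) x → ∣ p ∣ ≤ suc ∣ p - x ∣
  ∣p∣≤1+∣p-x∣ (inside  ∷ p) zero    = s≤s (ℕP.≤-reflexive (cong ∣_∣ (sym (SP.p─⊥≡p p))))
  ∣p∣≤1+∣p-x∣ (outside ∷ p) zero    = ℕP.m≤n⇒m≤1+n (ℕP.≤-reflexive (cong ∣_∣ (sym (SP.p─⊥≡p p))))
  ∣p∣≤1+∣p-x∣ (inside  ∷ p) (suc x) = s≤s (∣p∣≤1+∣p-x∣ p x)
  ∣p∣≤1+∣p-x∣ (outside ∷ p) (suc x) = ∣p∣≤1+∣p-x∣ p x

  x∉p-x : ∀ {n} (p : Subset n) x → ¬ x ∈ p - x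
  x∉p-x (_ ∷ p) zero    ()
  x∉p-x (_ ∷ p) (suc x) (there x∈p-x) = x∉p-x p x x∈p-x

  x∈p-y⇒x≢y : ∀ {n} {p : Subset n} {x y} → x ∈ p - y → x ≢ y
  x∈p-y⇒x≢y {p = p} {y = y} x∈p-y refl = x∉p-x p y x∈p-y

  x∈p-y⇒x∈p : ∀ {n} {p : Subset n} {x y} → x ∈ p - y → x ∈ p
  x∈p-y⇒x∈p {p = p} {y = y} = SP.p─q⊆p p S.⁅ y ⁆

module Rationals where
  open import Data.Rational using (_≤_)

  ⟦⟧≡mkℚ : ∀ n → ⟦ n ⟧ ≡ mkℚ (ℤ.+ n) 0 (coprime-sym (1-coprimeTo n))
  ⟦⟧≡mkℚ n = ℚP.normalize-coprime _

  ⟦⟧-+ : ∀ m n → ⟦ m ℕ.+ n ⟧ ≡ ⟦ m ⟧ + ⟦ n ⟧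
  ⟦⟧-+ m n rewrite ⟦⟧≡mkℚ m | ⟦⟧≡mkℚ n =
    ℚP./-cong (sym (cong₂ ℤ._+_ (ℤP.*-identityʳ (ℤ.+ m)) (ℤP.*-identityʳ (ℤ.+ n)))) refl

  ⟦⟧-injective : ∀ {m n} → ⟦ m ⟧ ≡ ⟦ n ⟧ → m ≡ n
  ⟦⟧-injective {m} {n} eq rewrite ⟦⟧≡mkℚ m | ⟦⟧≡mkℚ n = ℤP.+-injective (cong ℚ.↥_ eq)

  0≤⟦⟧ : ∀ n → 0ℚ ≤ ⟦ n ⟧
  0≤⟦⟧ n rewrite ⟦⟧≡mkℚ n = ℚP.nonNegative⁻¹ _

  ⟦⟧-mono-≤ : ∀ {m n} → m ℕ.≤ n → ⟦ m ⟧ ≤ ⟦ n ⟧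
  ⟦⟧-mono-≤ {m} {n} m≤n = subst₂ _≤_ (ℚP.+-identityʳ ⟦ m ⟧) ⟦m+[n∸m]⟧≡⟦n⟧ (ℚP.+-monoʳ-≤ ⟦ m ⟧ (0≤⟦⟧ (n ∸ m)))
    where
    ⟦m+[n∸m]⟧≡⟦n⟧ : ⟦ m ⟧ + ⟦ n ∸ m ⟧ ≡ ⟦ n ⟧
    ⟦m+[n∸m]⟧≡⟦n⟧ = trans (sym (⟦⟧-+ m (n ∸ m))) (cong ⟦_⟧ (ℕP.m+[n∸m]≡n m≤n))

  recip : ℕ → ℚ
  recip zero    = 0ℚ
  recip (suc t) = ratio 1 (suc t)

  ratio-zeroˡ : ∀ t → ratio 0 t ≡ 0ℚ
  ratio-zeroˡ zero    = refl
  ratio-zeroˡ (suc t) = ℚP.0/n≡0 (suc t)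

  recip≡mkℚ : ∀ t → recip (suc t) ≡ mkℚ (ℤ.+ 1) t (1-coprimeTo (suc t))
  recip≡mkℚ t = ℚP.normalize-coprime _

  recip-inverseʳ : ∀ t → ⟦ suc t ⟧ * recip (suc t) ≡ 1ℚ
  recip-inverseʳ t rewrite recip≡mkℚ t | ⟦⟧≡mkℚ (suc t) = ℚP.*-inverseʳ (mkℚ (ℤ.+ suc t) 0 (coprime-sym (1-coprimeTo (suc t))))

  0≤recip : ∀ t → 0ℚ ≤ recip t
  0≤recip zero    = ℚP.≤-refl
  0≤recip (suc t) rewrite recip≡mkℚ t = ℚP.nonNegative⁻¹ _

  ⟦⟧*recip≤1 : ∀ t → ⟦ t ⟧ * recip t ≤ 1ℚ
  ⟦⟧*recip≤1 zero    = ℚP.≤ᵇ⇒≤ _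
  ⟦⟧*recip≤1 (suc t) = ℚP.≤-reflexive (recip-inverseʳ t)

  ⟦⟧*recip≡1 : ∀ {t} → t ≢ 0 → ⟦ t ⟧ * recip t ≡ 1ℚ
  ⟦⟧*recip≡1 {zero}  t≢0 = ⊥-elim (t≢0 refl)
  ⟦⟧*recip≡1 {suc t} _   = recip-inverseʳ t

  0≤* : ∀ {a b} → 0ℚ ≤ a → 0ℚ ≤ b → 0ℚ ≤ a * b
  0≤* {a} {b} 0≤a 0≤b = subst (_≤ a * b) (ℚP.*-zeroʳ a) (*-monoʳ-≤ 0≤a 0≤b)
    where
    *-monoʳ-≤ : ∀ {a b c} → 0ℚ ≤ a → b ≤ c → a * b ≤ a * c
    *-monoʳ-≤ {a} 0≤a = ℚP.*-monoˡ-≤-nonNeg a {{ℚ.nonNegative 0≤a}}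

  +≡0⇒≡0ˡ : ∀ {a b} → 0ℚ ≤ a → 0ℚ ≤ b → a + b ≡ 0ℚ → a ≡ 0ℚ
  +≡0⇒≡0ˡ {a} 0≤a 0≤b a+b≡0 =
    ℚP.≤-antisym (subst₂ _≤_ (ℚP.+-identityʳ a) a+b≡0 (ℚP.+-monoʳ-≤ a 0≤b)) 0≤a

  ListCond-transfer : ∀ {e₁ l₁ e₂ l₂ : ℕ} {X : ℚ} → ⟦ e₁ ⟧ + X + 1ℚ ≤ ⟦ l₁ ⟧ → e₂ ℕ.+ l₁ ℕ.≤ e₁ ℕ.+ l₂ →
                      ⟦ e₂ ⟧ + X + 1ℚ ≤ ⟦ l₂ ⟧
  ListCond-transfer {e₁} {l₁} {e₂} {l₂} {X} cond₁ e₂+l₁≤e₁+l₂ = +-cancelʳ-≤ (begin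
      ⟦ e₂ ⟧ + X + 1ℚ + ⟦ e₁ ⟧
    ≡⟨ regroup ⟦ e₂ ⟧ X 1ℚ ⟦ e₁ ⟧ ⟩
      ⟦ e₂ ⟧ + (⟦ e₁ ⟧ + X + 1ℚ)
    ≤⟨ ℚP.+-monoʳ-≤ ⟦ e₂ ⟧ cond₁ ⟩
      ⟦ e₂ ⟧ + ⟦ l₁ ⟧
    ≡⟨ sym (⟦⟧-+ e₂ l₁) ⟩
      ⟦ e₂ ℕ.+ l₁ ⟧
    ≤⟨ ⟦⟧-mono-≤ e₂+l₁≤e₁+l₂ ⟩
      ⟦ e₁ ℕ.+ l₂ ⟧
    ≡⟨ trans (⟦⟧-+ e₁ l₂) (ℚP.+-comm ⟦ e₁ ⟧ ⟦ l₂ ⟧) ⟩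
      ⟦ l₂ ⟧ + ⟦ e₁ ⟧
    ∎)
    where
    open ℚP.≤-Reasoning
    open +-*-Solver using (solve; _:+_; _:=_; :-_)
    regroup : ∀ a x o b → a + x + o + b ≡ a + (b + x + o)
    regroup = solve 4 (λ a x o b → a :+ x :+ o :+ b := a :+ (b :+ x :+ o)) refl
    +-cancelʳ-≤ : ∀ {a b c} → a + c ≤ b + c → a ≤ b
    +-cancelʳ-≤ {a} {b} {c} a+c≤b+c = subst₂ _≤_ (+-inverse a c) (+-inverse b c) (ℚP.+-monoˡ-≤ (ℚ.- c) a+c≤b+c)
      where
      +-inverse : ∀ a c → a + c + ℚ.- c ≡ a
      +-inverse = solve 2 (λ a c → a :+ c :+ (:- c) := a) refl

module Sums where
  open import Data.Rational using (_≤_)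
  open Rationals

  ∑ : {A : Set} → List A → (A → ℚ) → ℚ
  ∑ xs f = sumℚ (map f xs)

  module _ {A : Set} where

    ∑-cong : ∀ (xs : List A) {f g : A → ℚ} → (∀ x → f x ≡ g x) → ∑ xs f ≡ ∑ xs g
    ∑-cong []       f≗g = refl
    ∑-cong (x ∷ xs) f≗g = cong₂ _+_ (f≗g x) (∑-cong xs f≗g)

    ∑-zero : ∀ (xs : List A) → ∑ xs (λ _ → 0ℚ) ≡ 0ℚ
    ∑-zero []       = refl
    ∑-zero (x ∷ xs) = trans (ℚP.+-identityˡ _) (∑-zero xs)

    ∑-+ : ∀ (xs : List A) (f g : A → ℚ) → ∑ xs (λ x → f x + g x) ≡ ∑ xs f + ∑ xs g
    ∑-+ []       f g = refl
    ∑-+ (x ∷ xs) f g rewrite ∑-+ xs f g = interchange (f x) (g x) (∑ xs f) (∑ xs g)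
      where
      open +-*-Solver
      interchange : ∀ a b c d → (a + b) + (c + d) ≡ (a + c) + (b + d)
      interchange = solve 4 (λ a b c d → (a :+ b) :+ (c :+ d) := (a :+ c) :+ (b :+ d)) refl

    ∑-*ˡ : ∀ (xs : List A) (c : ℚ) (f : A → ℚ) → ∑ xs (λ x → c * f x) ≡ c * ∑ xs f
    ∑-*ˡ []       c f = sym (ℚP.*-zeroʳ c)
    ∑-*ˡ (x ∷ xs) c f rewrite ∑-*ˡ xs c f = sym (ℚP.*-distribˡ-+ c (f x) (∑ xs f))

    ∑-*ʳ : ∀ (xs : List A) (c : ℚ) (f : A → ℚ) → ∑ xs (λ x → f x * c) ≡ ∑ xs f * c
    ∑-*ʳ xs c f = trans (∑-cong xs (λ x → ℚP.*-comm (f x) c)) (trans (∑-*ˡ xs c f) (ℚP.*-comm c _))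

    ∑-++ : ∀ (xs ys : List A) (f : A → ℚ) → ∑ (xs ++ ys) f ≡ ∑ xs f + ∑ ys f
    ∑-++ []       ys f = sym (ℚP.+-identityˡ _)
    ∑-++ (x ∷ xs) ys f rewrite ∑-++ xs ys f = sym (ℚP.+-assoc (f x) (∑ xs f) (∑ ys f))

    ∑-mono-≤ : ∀ (xs : List A) {f g : A → ℚ} → (∀ x → f x ≤ g x) → ∑ xs f ≤ ∑ xs g
    ∑-mono-≤ []       f≤g = ℚP.≤-refl
    ∑-mono-≤ (x ∷ xs) f≤g = ℚP.+-mono-≤ (f≤g x) (∑-mono-≤ xs f≤g)

    0≤∑ : ∀ (xs : List A) {f : A → ℚ} → (∀ x → 0ℚ ≤ f x) → 0ℚ ≤ ∑ xs f
    0≤∑ xs {f} 0≤f = subst (_≤ ∑ xs f) (∑-zero xs) (∑-mono-≤ xs 0≤f)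

    ∑-map : ∀ {B : Set} (xs : List B) (h : B → A) (f : A → ℚ) → ∑ (map h xs) f ≡ ∑ xs (f ∘ h)
    ∑-map []       h f = refl
    ∑-map (x ∷ xs) h f = cong (f (h x) +_) (∑-map xs h f)

    ∑-concatMap : ∀ {B : Set} (xs : List B) (g : B → List A) (f : A → ℚ) →
                  ∑ (concatMap g xs) f ≡ ∑ xs (λ x → ∑ (g x) f)
    ∑-concatMap []       g f = refl
    ∑-concatMap (x ∷ xs) g f =
      trans (∑-++ (g x) (concatMap g xs) f) (cong (∑ (g x) f +_) (∑-concatMap xs g f))

    ∑≡0⇒≡0 : ∀ (xs : List A) {f : A → ℚ} → (∀ x → 0ℚ ≤ f x) → ∑ xs f ≡ 0ℚ →
             ∀ {x} → x ∈ˡ xs → f x ≡ 0ℚ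
    ∑≡0⇒≡0 (y ∷ xs) 0≤f sum≡0 (here refl) = +≡0⇒≡0ˡ (0≤f y) (0≤∑ xs 0≤f) sum≡0
    ∑≡0⇒≡0 (y ∷ xs) {f} 0≤f sum≡0 (there x∈xs) =
      ∑≡0⇒≡0 xs 0≤f (+≡0⇒≡0ˡ (0≤∑ xs 0≤f) (0≤f y) (trans (ℚP.+-comm (∑ xs f) (f y)) sum≡0)) x∈xs

  ∑-swap : ∀ {A B : Set} (xs : List A) (ys : List B) (f : A → B → ℚ) →
           ∑ xs (λ x → ∑ ys (λ y → f x y)) ≡ ∑ ys (λ y → ∑ xs (λ x → f x y))
  ∑-swap []       ys f = sym (∑-zero ys)
  ∑-swap (x ∷ xs) ys f rewrite ∑-swap xs ys f = sym (∑-+ ys (f x) (λ y → ∑ xs (λ x → f x y)))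

  when : ∀ {P : Set} → Dec P → ℚ → ℚ
  when (yes _) a = a
  when (no _)  a = 0ℚ

  module _ {P : Set} where

    when-yes : ∀ (d : Dec P) a → P → when d a ≡ a
    when-yes (yes _) a p = refl
    when-yes (no ¬p) a p = ⊥-elim (¬p p)

    when-no : ∀ (d : Dec P) a → ¬ P → when d a ≡ 0ℚ
    when-no (yes p) a ¬p = ⊥-elim (¬p p)
    when-no (no _)  a ¬p = refl

    when-zero : ∀ (d : Dec P) → when d 0ℚ ≡ 0ℚ
    when-zero (yes _) = refl
    when-zero (no _)  = refl

    0≤when : ∀ (d : Dec P) {a} → 0ℚ ≤ a → 0ℚ ≤ when d a
    0≤when (yes _) 0≤a = 0≤a
    0≤when (no _)  0≤a = ℚP.≤-refl

    when-*ˡ : ∀ (d : Dec P) a b → when d a * b ≡ when d (a * b)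
    when-*ˡ (yes _) a b = refl
    when-*ˡ (no _)  a b = ℚP.*-zeroˡ b

    when-cong : ∀ {Q : Set} (d : Dec P) (e : Dec Q) a → (P → Q) → (Q → P) → when d a ≡ when e a
    when-cong (yes p) (yes q) a P⇒Q Q⇒P = refl
    when-cong (yes p) (no ¬q) a P⇒Q Q⇒P = ⊥-elim (¬q (P⇒Q p))
    when-cong (no ¬p) (yes q) a P⇒Q Q⇒P = ⊥-elim (¬p (Q⇒P q))
    when-cong (no ¬p) (no ¬q) a P⇒Q Q⇒P = refl

    when-×-dec : ∀ {Q : Set} (d : Dec P) (e : Dec Q) a → when (d ×-dec e) a ≡ when d (when e a)
    when-×-dec (yes _) (yes _) a = refl
    when-×-dec (yes _) (no _)  a = refl
    when-×-dec (no _)  e       a = refl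

    when-swap : ∀ {Q : Set} (d : Dec P) (e : Dec Q) a → when d (when e a) ≡ when e (when d a)
    when-swap (yes _) e       a = refl
    when-swap (no _)  (yes _) a = refl
    when-swap (no _)  (no _)  a = refl

    ∑-when : ∀ {A : Set} (xs : List A) (d : Dec P) (f : A → ℚ) → ∑ xs (λ x → when d (f x)) ≡ when d (∑ xs f)
    ∑-when xs (yes _) f = refl
    ∑-when xs (no _)  f = ∑-zero xs

  filter-nonempty : ∀ {A : Set} {P : A → Set} (P? : ∀ x → Dec (P x)) (xs : List A) →
                    length (filter P? xs) ≢ 0 → Σ A P
  filter-nonempty P? []       length≢0 = ⊥-elim (length≢0 refl)
  filter-nonempty P? (x ∷ xs) length≢0 with P? x
  ... | yes p = x , p
  ... | no _  = filter-nonempty P? xs length≢0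

  ⟦length-filter⟧ : ∀ {A : Set} {P : A → Set} (P? : ∀ x → Dec (P x)) (xs : List A) →
                    ⟦ length (filter P? xs) ⟧ ≡ ∑ xs (λ x → when (P? x) 1ℚ)
  ⟦length-filter⟧ P? []       = refl
  ⟦length-filter⟧ P? (x ∷ xs) with P? x
  ... | yes _ = trans (⟦⟧-+ 1 (length (filter P? xs))) (cong (1ℚ +_) (⟦length-filter⟧ P? xs))
  ... | no _  = trans (⟦length-filter⟧ P? xs) (sym (ℚP.+-identityˡ _))

  ∑-filter : ∀ {A : Set} {P : A → Set} (P? : ∀ x → Dec (P x)) (xs : List A) (h : A → ℚ) →
             ∑ (filter P? xs) h ≡ ∑ xs (λ x → when (P? x) (h x))
  ∑-filter P? []       h = refl
  ∑-filter P? (x ∷ xs) h with P? x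
  ... | yes _ = cong (h x +_) (∑-filter P? xs h)
  ... | no _  = trans (∑-filter P? xs h) (sym (ℚP.+-identityˡ _))

  ∑-allFin-suc : ∀ n (h : Fin (suc n) → ℚ) → ∑ (allFin (suc n)) h ≡ h zero + ∑ (allFin n) (h ∘ suc)
  ∑-allFin-suc n h = cong (h zero +_) (∑-tabulate n suc h)
    where
    ∑-tabulate : ∀ {A : Set} n (f : Fin n → A) (h : A → ℚ) → ∑ (List.tabulate f) h ≡ ∑ (allFin n) (h ∘ f)
    ∑-tabulate zero    f h = refl
    ∑-tabulate (suc n) f h =
      cong (h (f zero) +_) (trans (∑-tabulate n (f ∘ suc) h) (sym (∑-tabulate n suc (h ∘ f))))

  ∑-select : ∀ n (d : Fin n) (g : Fin n → ℚ) → ∑ (allFin n) (λ c → when (c ≟ d) (g c)) ≡ g d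
  ∑-select (suc n) zero g = begin
      ∑ (allFin (suc n)) (λ c → when (c ≟ zero) (g c))
    ≡⟨ ∑-allFin-suc n (λ c → when (c ≟ zero) (g c)) ⟩
      g zero + ∑ (allFin n) (λ c → when (suc c ≟ zero) (g (suc c)))
    ≡⟨ cong (g zero +_) (trans (∑-cong (allFin n) (λ c → when-no (suc c ≟ zero) (g (suc c)) λ ())) (∑-zero (allFin n))) ⟩
      g zero + 0ℚ
    ≡⟨ ℚP.+-identityʳ (g zero) ⟩
      g zero
    ∎
    where open ≡-Reasoning
  ∑-select (suc n) (suc d) g = begin
      ∑ (allFin (suc n)) (λ c → when (c ≟ suc d) (g c))
    ≡⟨ ∑-allFin-suc n (λ c → when (c ≟ suc d) (g c)) ⟩
      0ℚ + ∑ (allFin n) (λ c → when (suc c ≟ suc d) (g (suc c)))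
    ≡⟨ ℚP.+-identityˡ _ ⟩
      ∑ (allFin n) (λ c → when (suc c ≟ suc d) (g (suc c)))
    ≡⟨ ∑-cong (allFin n) (λ c → when-cong (suc c ≟ suc d) (c ≟ d) _ FP.suc-injective (cong suc)) ⟩
      ∑ (allFin n) (λ c → when (c ≟ d) (g (suc c)))
    ≡⟨ ∑-select n d (g ∘ suc) ⟩
      g (suc d)
    ∎
    where open ≡-Reasoning

  module SumsOverVectors (q : ℕ) where

    ∑V : ∀ k → (Vec (Fin q) k → ℚ) → ℚ
    ∑V k f = ∑ (allVecs q k) f

    ∑V-cong : ∀ k {f g : Vec (Fin q) k → ℚ} → (∀ x → f x ≡ g x) → ∑V k f ≡ ∑V k g
    ∑V-cong k = ∑-cong (allVecs q k)

    ∑V-∷ : ∀ k (f : Vec (Fin q) (suc k) → ℚ) → ∑V (suc k) f ≡ ∑ (allFin q) (λ c → ∑V k (λ ρ → f (c ∷ ρ)))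
    ∑V-∷ k f = trans (∑-concatMap (allFin q) (λ c → map (c ∷_) (allVecs q k)) f)
                     (∑-cong (allFin q) (λ c → ∑-map (allVecs q k) (c ∷_) f))

    ∑V-insertAt : ∀ k (p : Fin (suc k)) (f : Vec (Fin q) (suc k) → ℚ) →
                  ∑V (suc k) f ≡ ∑ (allFin q) (λ c → ∑V k (λ ρ → f (insertAt ρ p c)))
    ∑V-insertAt k       zero    f = ∑V-∷ k f
    ∑V-insertAt (suc k) (suc p) f = begin
        ∑V (suc (suc k)) f
      ≡⟨ ∑V-∷ (suc k) f ⟩
        ∑ (allFin q) (λ x → ∑V (suc k) (λ ρ → f (x ∷ ρ)))
      ≡⟨ ∑-cong (allFin q) (λ x → ∑V-insertAt k p (λ ρ → f (x ∷ ρ))) ⟩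
        ∑ (allFin q) (λ x → ∑ (allFin q) (λ c → ∑V k (λ ρ → f (x ∷ insertAt ρ p c))))
      ≡⟨ ∑-swap (allFin q) (allFin q) _ ⟩
        ∑ (allFin q) (λ c → ∑ (allFin q) (λ x → ∑V k (λ ρ → f (x ∷ insertAt ρ p c))))
      ≡⟨ ∑-cong (allFin q) (λ c → sym (∑V-∷ k (λ ρ → f (insertAt ρ (suc p) c)))) ⟩
        ∑ (allFin q) (λ c → ∑V (suc k) (λ ρ → f (insertAt ρ (suc p) c)))
      ∎
      where open ≡-Reasoning

    _≟ᵛ_ : ∀ {k} (x y : Vec (Fin q) k) → Dec (x ≡ y)
    _≟ᵛ_ = VecP.≡-dec _≟_

    ∑V-select : ∀ k (τ : Vec (Fin q) k) (g : Vec (Fin q) k → ℚ) → ∑V k (λ ρ → when (ρ ≟ᵛ τ) (g ρ)) ≡ g τ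
    ∑V-select zero    []      g = ℚP.+-identityʳ _
    ∑V-select (suc k) (t ∷ τ) g = begin
        ∑V (suc k) (λ ρ → when (ρ ≟ᵛ (t ∷ τ)) (g ρ))
      ≡⟨ ∑V-∷ k _ ⟩
        ∑ (allFin q) (λ c → ∑V k (λ ρ → when ((c ∷ ρ) ≟ᵛ (t ∷ τ)) (g (c ∷ ρ))))
      ≡⟨ ∑-cong (allFin q) (λ c → ∑V-cong k (λ ρ → when-∷ c ρ)) ⟩
        ∑ (allFin q) (λ c → ∑V k (λ ρ → when (c ≟ t) (when (ρ ≟ᵛ τ) (g (c ∷ ρ)))))
      ≡⟨ ∑-cong (allFin q) (λ c → ∑-when (allVecs q k) (c ≟ t) _) ⟩
        ∑ (allFin q) (λ c → when (c ≟ t) (∑V k (λ ρ → when (ρ ≟ᵛ τ) (g (c ∷ ρ)))))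
      ≡⟨ ∑-select q t _ ⟩
        ∑V k (λ ρ → when (ρ ≟ᵛ τ) (g (t ∷ ρ)))
      ≡⟨ ∑V-select k τ (λ ρ → g (t ∷ ρ)) ⟩
        g (t ∷ τ)
      ∎
      where
      open ≡-Reasoning
      when-∷ : ∀ c ρ → when ((c ∷ ρ) ≟ᵛ (t ∷ τ)) (g (c ∷ ρ)) ≡ when (c ≟ t) (when (ρ ≟ᵛ τ) (g (c ∷ ρ)))
      when-∷ c ρ = trans (when-cong ((c ∷ ρ) ≟ᵛ (t ∷ τ)) (c ≟ t ×-dec ρ ≟ᵛ τ) _ VecP.∷-injective
                                    (λ (c≡t , ρ≡τ) → cong₂ _∷_ c≡t ρ≡τ))
                         (when-×-dec (c ≟ t) (ρ ≟ᵛ τ) _)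

    ∈-allVecs : ∀ {k} (τ : Vec (Fin q) k) → τ ∈ˡ allVecs q k
    ∈-allVecs []      = here refl
    ∈-allVecs (t ∷ τ) = ∈-concatMap (allFin q) (∈-map⁺ (t ∷_) (∈-allVecs τ)) (∈-allFin t)
      where
      ∈-concatMap : ∀ {A B : Set} {g : A → List B} {x y} (ys : List A) → x ∈ˡ g y → y ∈ˡ ys → x ∈ˡ concatMap g ys
      ∈-concatMap         (y ∷ ys) x∈gy (here refl) = ∈-++⁺ˡ x∈gy
      ∈-concatMap {g = g} (y ∷ ys) x∈gy (there y∈ys) = ∈-++⁺ʳ (g y) (∈-concatMap ys x∈gy y∈ys)

    ∑V≡0⇒≡0 : ∀ k {f : Vec (Fin q) k → ℚ} → (∀ x → 0ℚ ≤ f x) → ∑V k f ≡ 0ℚ → ∀ x → f x ≡ 0ℚ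
    ∑V≡0⇒≡0 k 0≤f sum≡0 x = ∑≡0⇒≡0 (allVecs q k) 0≤f sum≡0 (∈-allVecs x)

    ∑V-pin : ∀ k (p : Fin (suc k)) y (F : Vec (Fin q) (suc k) → ℚ) →
             ∑V (suc k) (λ σ → when (lookup σ p ≟ y) (F σ)) ≡ ∑V k (λ ρ → F (insertAt ρ p y))
    ∑V-pin k p y F = begin
        ∑V (suc k) (λ σ → when (lookup σ p ≟ y) (F σ))
      ≡⟨ ∑V-insertAt k p _ ⟩
        ∑ (allFin q) (λ c → ∑V k (λ ρ → when (lookup (insertAt ρ p c) p ≟ y) (F (insertAt ρ p c))))
      ≡⟨ ∑-cong (allFin q) (λ c → ∑V-cong k (λ ρ → cong (λ z → when (z ≟ y) (F (insertAt ρ p c)))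
                                                         (VecP.insertAt-lookup ρ p c))) ⟩
        ∑ (allFin q) (λ c → ∑V k (λ ρ → when (c ≟ y) (F (insertAt ρ p c))))
      ≡⟨ ∑-cong (allFin q) (λ c → ∑-when (allVecs q k) (c ≟ y) _) ⟩
        ∑ (allFin q) (λ c → when (c ≟ y) (∑V k (λ ρ → F (insertAt ρ p c))))
      ≡⟨ ∑-select q y _ ⟩
        ∑V k (λ ρ → F (insertAt ρ p y))
      ∎
      where open ≡-Reasoning

    ∑V-when-pinned : ∀ k (p : Fin (suc k)) b {Q : Vec (Fin q) (suc k) → Set} (Q? : ∀ σ → Dec (Q σ)) →
                     (∀ σ → Q σ → lookup σ p ≡ b) → (F : Vec (Fin q) (suc k) → ℚ) →
                     ∑V (suc k) (λ σ → when (Q? σ) (F σ)) ≡ ∑V k (λ ρ → when (Q? (insertAt ρ p b)) (F (insertAt ρ p b)))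
    ∑V-when-pinned k p b Q? Q⇒pinned F = trans (∑V-cong (suc k) pinned) (∑V-pin k p b _)
      where
      pinned : ∀ σ → when (Q? σ) (F σ) ≡ when (lookup σ p ≟ b) (when (Q? σ) (F σ))
      pinned σ with Q? σ
      ... | yes Qσ = sym (when-yes (lookup σ p ≟ b) (F σ) (Q⇒pinned σ Qσ))
      ... | no _   = sym (when-zero (lookup σ p ≟ b))

module Hamming where
  open import Data.Nat using (_≤_)

  ham₁ : ∀ {q} → Fin q → Fin q → ℕ
  ham₁ c d = ham (c ∷ []) (d ∷ [])

  ham-refl : ∀ {q k} (x : Vec (Fin q) k) → ham x x ≡ 0
  ham-refl []      = refl
  ham-refl (a ∷ x) with a ≟ a
  ... | yes _ = ham-refl x
  ... | no a≢a = ⊥-elim (a≢a refl)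

  ham₁≡1 : ∀ {q} {c d : Fin q} → c ≢ d → ham₁ c d ≡ 1
  ham₁≡1 {c = c} {d} c≢d with c ≟ d
  ... | yes c≡d = ⊥-elim (c≢d c≡d)
  ... | no _    = refl

  ham-insertAt : ∀ {q k} (ρ ρ′ : Vec (Fin q) k) (p : Fin (suc k)) c d →
                 ham (insertAt ρ p c) (insertAt ρ′ p d) ≡ ham₁ c d ℕ.+ ham ρ ρ′
  ham-insertAt ρ ρ′ zero c d with c ≟ d
  ... | yes _ = refl
  ... | no _  = refl
  ham-insertAt (a ∷ ρ) (b ∷ ρ′) (suc p) c d with a ≟ b
  ... | yes _ = ham-insertAt ρ ρ′ p c d
  ... | no _  = trans (cong suc (ham-insertAt ρ ρ′ p c d)) (sym (ℕP.+-suc (ham₁ c d) (ham ρ ρ′)))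

  ham₁-triangle : ∀ {q} (a b c : Fin q) → ham₁ a c ≤ ham₁ a b ℕ.+ ham₁ b c
  ham₁-triangle a b c with a ≟ c | a ≟ b
  ... | yes _ | _       = z≤n
  ... | no _  | no _    = s≤s z≤n
  ... | no a≢c | yes refl = ℕP.≤-reflexive (sym (ham₁≡1 a≢c))

  ham-triangle : ∀ {q k} (x y z : Vec (Fin q) k) → ham x z ≤ ham x y ℕ.+ ham y z
  ham-triangle []      []      []      = z≤n
  ham-triangle (a ∷ x) (b ∷ y) (c ∷ z)
    rewrite ham-insertAt x z zero a c | ham-insertAt x y zero a b | ham-insertAt y z zero b c =
    ℕP.≤-trans (ℕP.+-mono-≤ (ham₁-triangle a b c) (ham-triangle x y z))
               (ℕP.≤-reflexive (ℕ-+.interchange (ham₁ a b) (ham₁ b c) (ham x y) (ham y z)))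

module Couplings (q : ℕ) where
  open import Data.Rational using (_≤_)
  open Rationals
  open Sums
  open SumsOverVectors q
  open Hamming

  V : ℕ → Set
  V k = Vec (Fin q) k

  cost : ∀ {k} → (V k → V k → ℚ) → ℚ
  cost {k} π = ∑V k (λ x → ∑V k (λ y → π x y * ⟦ ham x y ⟧))

  record Coupling {k} (μ ν : V k → ℚ) (r : ℚ) : Set where
    field
      π         : V k → V k → ℚ
      0≤π       : ∀ x y → 0ℚ ≤ π x y
      marginalˡ : ∀ x → ∑V k (λ y → π x y) ≡ μ x
      marginalʳ : ∀ y → ∑V k (λ x → π x y) ≡ ν y
      cost≤     : cost π ≤ r

  sumℚ-concatMap≡cost : ∀ {k} (π : V k → V k → ℚ) →
    sumℚ (concatMap (λ x → map (λ y → π x y * ⟦ ham x y ⟧) (allVecs q k)) (allVecs q k)) ≡ cost π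
  sumℚ-concatMap≡cost {k} π = begin
      sumℚ (concatMap row (allVecs q k))
    ≡⟨ cong sumℚ (sym (Data.List.Properties.map-id (concatMap row (allVecs q k)))) ⟩
      ∑ (concatMap row (allVecs q k)) (λ z → z)
    ≡⟨ ∑-concatMap (allVecs q k) row (λ z → z) ⟩
      ∑V k (λ x → ∑ (row x) (λ z → z))
    ≡⟨ ∑V-cong k (λ x → ∑-map (allVecs q k) (λ y → π x y * ⟦ ham x y ⟧) (λ z → z)) ⟩
      cost π
    ∎
    where
    open ≡-Reasoning
    row : V k → List ℚ
    row x = map (λ y → π x y * ⟦ ham x y ⟧) (allVecs q k)

  coupling : ∀ {k} {μ ν : V k → ℚ} {r} → W1≤ μ ν r → Coupling μ ν r
  coupling (π , 0≤π , marginalˡ , marginalʳ , cost≤) =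
    record { π = π ; 0≤π = 0≤π ; marginalˡ = marginalˡ ; marginalʳ = marginalʳ
           ; cost≤ = subst (_≤ _) (sumℚ-concatMap≡cost π) cost≤ }

  W1≤-coupling : ∀ {k} {μ ν : V k → ℚ} {r} → Coupling μ ν r → W1≤ μ ν r
  W1≤-coupling C = π , 0≤π , marginalˡ , marginalʳ , subst (_≤ _) (sym (sumℚ-concatMap≡cost π)) cost≤
    where open Coupling C

  module _ {k : ℕ} where

    W1≤-mono : ∀ {μ ν : V k → ℚ} {r r′} → r ≤ r′ → W1≤ μ ν r → W1≤ μ ν r′
    W1≤-mono r≤r′ (π , 0≤π , m₁ , m₂ , c) = π , 0≤π , m₁ , m₂ , ℚP.≤-trans c r≤r′

    W1≤-cong : ∀ {μ μ′ ν ν′ : V k → ℚ} {r} → (∀ x → μ x ≡ μ′ x) → (∀ x → ν x ≡ ν′ x) →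
               W1≤ μ ν r → W1≤ μ′ ν′ r
    W1≤-cong μ≗μ′ ν≗ν′ (π , 0≤π , m₁ , m₂ , c) =
      π , 0≤π , (λ x → trans (m₁ x) (μ≗μ′ x)) , (λ y → trans (m₂ y) (ν≗ν′ y)) , c

    W1≤⇒∑≡ : ∀ {μ ν : V k → ℚ} {r} → W1≤ μ ν r → ∑V k μ ≡ ∑V k ν
    W1≤⇒∑≡ W = trans (sym (∑V-cong k marginalˡ)) (trans (∑-swap (allVecs q k) (allVecs q k) π) (∑V-cong k marginalʳ))
      where open Coupling (coupling W)

    W1≤⇒0≤r : ∀ {μ ν : V k → ℚ} {r} → W1≤ μ ν r → 0ℚ ≤ r
    W1≤⇒0≤r W = ℚP.≤-trans (0≤∑ (allVecs q k) (λ x → 0≤∑ (allVecs q k) (λ y → 0≤* (0≤π x y) (0≤⟦⟧ (ham x y))))) cost≤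
      where open Coupling (coupling W)

    W1≤-refl : (μ : V k → ℚ) → (∀ x → 0ℚ ≤ μ x) → W1≤ μ μ 0ℚ
    W1≤-refl μ 0≤μ = W1≤-coupling (record
      { π = diagonal ; 0≤π = λ x y → 0≤when (y ≟ᵛ x) (0≤μ x) ; marginalˡ = marginalˡ ; marginalʳ = marginalʳ
      ; cost≤ = ℚP.≤-reflexive cost≡0 })
      where
      diagonal : V k → V k → ℚ
      diagonal x y = when (y ≟ᵛ x) (μ x)
      marginalˡ : ∀ x → ∑V k (diagonal x) ≡ μ x
      marginalˡ x = ∑V-select k x (λ _ → μ x)
      marginalʳ : ∀ y → ∑V k (λ x → diagonal x y) ≡ μ y
      marginalʳ y = trans (∑V-cong k (λ x → when-cong (y ≟ᵛ x) (x ≟ᵛ y) (μ x) sym sym)) (∑V-select k y μ)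
      off-diagonal : ∀ x y → diagonal x y * ⟦ ham x y ⟧ ≡ 0ℚ
      off-diagonal x y with y ≟ᵛ x
      ... | yes refl rewrite ham-refl x = ℚP.*-zeroʳ (μ x)
      ... | no _     = ℚP.*-zeroˡ ⟦ ham x y ⟧
      cost≡0 : cost diagonal ≡ 0ℚ
      cost≡0 = trans (∑V-cong k (λ x → trans (∑V-cong k (off-diagonal x)) (∑-zero (allVecs q k))))
                     (∑-zero (allVecs q k))

  -- fixAt p x μ is the product of μ with the point mass at x, the latter placed at coordinate p.
  fixAt : ∀ {k} → Fin (suc k) → Fin q → (V k → ℚ) → V (suc k) → ℚ
  fixAt p x μ σ = when (lookup σ p ≟ x) (μ (removeAt σ p))

  ∑V-fixAt : ∀ k (p : Fin (suc k)) x (μ : V k → ℚ) → ∑V (suc k) (fixAt p x μ) ≡ ∑V k μ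
  ∑V-fixAt k p x μ = trans (∑V-pin k p x _) (∑V-cong k (λ ρ → cong μ (VecP.removeAt-insertAt ρ p x)))

  fixAt₂ : ∀ {k} → Fin (suc k) → Fin q → Fin q → (V k → V k → ℚ) → V (suc k) → V (suc k) → ℚ
  fixAt₂ p x y π σ σ′ = when (lookup σ p ≟ x) (fixAt p y (π (removeAt σ p)) σ′)

  cost-fixAt₂ : ∀ {k} (p : Fin (suc k)) x y (π : V k → V k → ℚ) →
                cost (fixAt₂ p x y π) ≡ ⟦ ham₁ x y ⟧ * ∑V k (λ ρ → ∑V k (π ρ)) + cost π
  cost-fixAt₂ {k} p x y π = begin
      ∑V (suc k) (λ σ → ∑V (suc k) (λ σ′ → fixAt₂ p x y π σ σ′ * h σ σ′))
    ≡⟨ ∑V-cong (suc k) inner ⟩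
      ∑V (suc k) (λ σ → when (lookup σ p ≟ x) (G (removeAt σ p) σ))
    ≡⟨ ∑V-pin k p x _ ⟩
      ∑V k (λ ρ → G (removeAt (insertAt ρ p x) p) (insertAt ρ p x))
    ≡⟨ ∑V-cong k (λ ρ → ∑V-cong k (λ ρ′ → split ρ ρ′)) ⟩
      ∑V k (λ ρ → ∑V k (λ ρ′ → ⟦ ham₁ x y ⟧ * π ρ ρ′ + π ρ ρ′ * ⟦ ham ρ ρ′ ⟧))
    ≡⟨ ∑V-cong k (λ ρ → ∑-+ (allVecs q k) _ _) ⟩
      ∑V k (λ ρ → ∑V k (λ ρ′ → ⟦ ham₁ x y ⟧ * π ρ ρ′) + ∑V k (λ ρ′ → π ρ ρ′ * ⟦ ham ρ ρ′ ⟧))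
    ≡⟨ ∑-+ (allVecs q k) _ _ ⟩
      ∑V k (λ ρ → ∑V k (λ ρ′ → ⟦ ham₁ x y ⟧ * π ρ ρ′)) + cost π
    ≡⟨ cong (_+ cost π) (trans (∑V-cong k (λ ρ → ∑-*ˡ (allVecs q k) h₁ (π ρ)))
                               (∑-*ˡ (allVecs q k) h₁ (λ ρ → ∑V k (π ρ)))) ⟩
      ⟦ ham₁ x y ⟧ * ∑V k (λ ρ → ∑V k (π ρ)) + cost π
    ∎
    where
    open ≡-Reasoning
    h₁ : ℚ
    h₁ = ⟦ ham₁ x y ⟧
    h : V (suc k) → V (suc k) → ℚ
    h σ σ′ = ⟦ ham σ σ′ ⟧
    G : V k → V (suc k) → ℚ
    G ρ σ = ∑V k (λ ρ′ → π ρ ρ′ * h σ (insertAt ρ′ p y))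
    inner : ∀ σ → ∑V (suc k) (λ σ′ → fixAt₂ p x y π σ σ′ * h σ σ′) ≡ when (lookup σ p ≟ x) (G (removeAt σ p) σ)
    inner σ = begin
        ∑V (suc k) (λ σ′ → fixAt₂ p x y π σ σ′ * h σ σ′)
      ≡⟨ ∑V-cong (suc k) (λ σ′ → trans (when-*ˡ (lookup σ p ≟ x) _ _) (cong (when (lookup σ p ≟ x)) (when-*ˡ (lookup σ′ p ≟ y) _ _))) ⟩
        ∑V (suc k) (λ σ′ → when (lookup σ p ≟ x) (when (lookup σ′ p ≟ y) (π (removeAt σ p) (removeAt σ′ p) * h σ σ′)))
      ≡⟨ ∑-when (allVecs q (suc k)) (lookup σ p ≟ x) _ ⟩
        when (lookup σ p ≟ x) (∑V (suc k) (λ σ′ → when (lookup σ′ p ≟ y) (π (removeAt σ p) (removeAt σ′ p) * h σ σ′)))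
      ≡⟨ cong (when (lookup σ p ≟ x)) (∑V-pin k p y _) ⟩
        when (lookup σ p ≟ x) (∑V k (λ ρ′ → π (removeAt σ p) (removeAt (insertAt ρ′ p y) p) * h σ (insertAt ρ′ p y)))
      ≡⟨ cong (when (lookup σ p ≟ x)) (∑V-cong k (λ ρ′ → cong (λ z → π (removeAt σ p) z * h σ (insertAt ρ′ p y))
                                                            (VecP.removeAt-insertAt ρ′ p y))) ⟩
        when (lookup σ p ≟ x) (G (removeAt σ p) σ)
      ∎
    split : ∀ ρ ρ′ → π (removeAt (insertAt ρ p x) p) ρ′ * h (insertAt ρ p x) (insertAt ρ′ p y)
                     ≡ ⟦ ham₁ x y ⟧ * π ρ ρ′ + π ρ ρ′ * ⟦ ham ρ ρ′ ⟧
    split ρ ρ′ rewrite VecP.removeAt-insertAt ρ p x | ham-insertAt ρ ρ′ p x y | ⟦⟧-+ (ham₁ x y) (ham ρ ρ′) =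
      trans (ℚP.*-distribˡ-+ (π ρ ρ′) h₁ ⟦ ham ρ ρ′ ⟧) (cong (_+ π ρ ρ′ * ⟦ ham ρ ρ′ ⟧) (ℚP.*-comm (π ρ ρ′) h₁))

  W1≤-fixAt : ∀ {k} (p : Fin (suc k)) x y {μ ν : V k → ℚ} {r} → ∑V k μ ≤ 1ℚ → W1≤ μ ν r →
              W1≤ (fixAt p x μ) (fixAt p y ν) (⟦ ham₁ x y ⟧ + r)
  W1≤-fixAt {k} p x y {μ} {ν} {r} ∑μ≤1 W = W1≤-coupling (record
    { π = fixAt₂ p x y π
    ; 0≤π = λ σ σ′ → 0≤when (lookup σ p ≟ x) (0≤when (lookup σ′ p ≟ y) (0≤π _ _))
    ; marginalˡ = marginalˡ′
    ; marginalʳ = marginalʳ′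
    ; cost≤ = cost≤′
    })
    where
    open Coupling (coupling W)
    marginalˡ′ : ∀ σ → ∑V (suc k) (fixAt₂ p x y π σ) ≡ fixAt p x μ σ
    marginalˡ′ σ = trans (∑-when (allVecs q (suc k)) (lookup σ p ≟ x) _)
                         (cong (when (lookup σ p ≟ x)) (trans (∑V-fixAt k p y _) (marginalˡ _)))
    marginalʳ′ : ∀ σ′ → ∑V (suc k) (λ σ → fixAt₂ p x y π σ σ′) ≡ fixAt p y ν σ′
    marginalʳ′ σ′ = begin
        ∑V (suc k) (λ σ → fixAt₂ p x y π σ σ′)
      ≡⟨ ∑V-cong (suc k) (λ σ → when-swap (lookup σ p ≟ x) (lookup σ′ p ≟ y) _) ⟩
        ∑V (suc k) (λ σ → when (lookup σ′ p ≟ y) (fixAt p x (λ ρ → π ρ (removeAt σ′ p)) σ))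
      ≡⟨ ∑-when (allVecs q (suc k)) (lookup σ′ p ≟ y) _ ⟩
        when (lookup σ′ p ≟ y) (∑V (suc k) (fixAt p x (λ ρ → π ρ (removeAt σ′ p))))
      ≡⟨ cong (when (lookup σ′ p ≟ y)) (trans (∑V-fixAt k p x _) (marginalʳ _)) ⟩
        fixAt p y ν σ′
      ∎
      where open ≡-Reasoning
    h₁ : ℚ
    h₁ = ⟦ ham₁ x y ⟧
    cost≤′ : cost (fixAt₂ p x y π) ≤ h₁ + r
    cost≤′ = begin
        cost (fixAt₂ p x y π)
      ≡⟨ cost-fixAt₂ p x y π ⟩
        h₁ * ∑V k (λ ρ → ∑V k (π ρ)) + cost π
      ≡⟨ cong (λ z → h₁ * z + cost π) (∑V-cong k marginalˡ) ⟩
        h₁ * ∑V k μ + cost π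
      ≤⟨ ℚP.+-mono-≤ (ℚP.*-monoˡ-≤-nonNeg h₁ {{ℚ.nonNegative (0≤⟦⟧ (ham₁ x y))}} ∑μ≤1) cost≤ ⟩
        h₁ * 1ℚ + r
      ≡⟨ cong (_+ r) (ℚP.*-identityʳ h₁) ⟩
        h₁ + r
      ∎
      where open ℚP.≤-Reasoning

  module _ {k : ℕ} where

    W1≤-+ : ∀ {μ₁ ν₁ μ₂ ν₂ : V k → ℚ} {r₁ r₂} → W1≤ μ₁ ν₁ r₁ → W1≤ μ₂ ν₂ r₂ →
            W1≤ (λ x → μ₁ x + μ₂ x) (λ y → ν₁ y + ν₂ y) (r₁ + r₂)
    W1≤-+ {r₁ = r₁} {r₂} W₁ W₂ = W1≤-coupling (record
      { π = π
      ; 0≤π = λ x y → ℚP.+-mono-≤ (C₁.0≤π x y) (C₂.0≤π x y)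
      ; marginalˡ = λ x → trans (∑-+ (allVecs q k) _ _) (cong₂ _+_ (C₁.marginalˡ x) (C₂.marginalˡ x))
      ; marginalʳ = λ y → trans (∑-+ (allVecs q k) _ _) (cong₂ _+_ (C₁.marginalʳ y) (C₂.marginalʳ y))
      ; cost≤ = ℚP.≤-trans (ℚP.≤-reflexive cost-π) (ℚP.+-mono-≤ C₁.cost≤ C₂.cost≤)
      })
      where
      module C₁ = Coupling (coupling W₁)
      module C₂ = Coupling (coupling W₂)
      π : V k → V k → ℚ
      π x y = C₁.π x y + C₂.π x y
      cost-π : cost π ≡ cost C₁.π + cost C₂.π
      cost-π = trans (∑V-cong k (λ x → trans (∑V-cong k (λ y → ℚP.*-distribʳ-+ ⟦ ham x y ⟧ (C₁.π x y) (C₂.π x y)))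
                                             (∑-+ (allVecs q k) _ _)))
                     (∑-+ (allVecs q k) _ _)

    W1≤-* : ∀ {μ ν : V k → ℚ} {r} a → 0ℚ ≤ a → W1≤ μ ν r → W1≤ (λ x → a * μ x) (λ y → a * ν y) (a * r)
    W1≤-* a 0≤a W = W1≤-coupling (record
      { π = λ x y → a * π x y
      ; 0≤π = λ x y → 0≤* 0≤a (0≤π x y)
      ; marginalˡ = λ x → trans (∑-*ˡ (allVecs q k) a (π x)) (cong (a *_) (marginalˡ x))
      ; marginalʳ = λ y → trans (∑-*ˡ (allVecs q k) a (λ x → π x y)) (cong (a *_) (marginalʳ y))
      ; cost≤ = ℚP.≤-trans (ℚP.≤-reflexive cost-aπ) (ℚP.*-monoˡ-≤-nonNeg a {{ℚ.nonNegative 0≤a}} cost≤)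
      })
      where
      open Coupling (coupling W)
      cost-aπ : cost (λ x y → a * π x y) ≡ a * cost π
      cost-aπ = trans (∑V-cong k (λ x → trans (∑V-cong k (λ y → ℚP.*-assoc a (π x y) ⟦ ham x y ⟧))
                                              (∑-*ˡ (allVecs q k) a _)))
                      (∑-*ˡ (allVecs q k) a _)

    W1≤-zero : W1≤ (λ (_ : V k) → 0ℚ) (λ _ → 0ℚ) 0ℚ
    W1≤-zero = W1≤-refl (λ _ → 0ℚ) (λ _ → ℚP.≤-refl)

    W1≤-convex : ∀ {A : Set} (cs : List A) (w : A → ℚ) {μs νs : A → V k → ℚ} {r} → (∀ c → 0ℚ ≤ w c) →
                 (∀ c → (w c ≡ 0ℚ) ⊎ W1≤ (μs c) (νs c) r) →
                 W1≤ (λ x → ∑ cs (λ c → w c * μs c x)) (λ y → ∑ cs (λ c → w c * νs c y)) (∑ cs (λ c → w c * r))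
    W1≤-convex []       w 0≤w components = W1≤-zero
    W1≤-convex (c ∷ cs) w {μs} {νs} {r} 0≤w components =
      W1≤-+ (weighted (components c)) (W1≤-convex cs w 0≤w components)
      where
      vanish : w c ≡ 0ℚ → ∀ a → 0ℚ ≡ w c * a
      vanish w≡0 a = sym (trans (cong (_* a) w≡0) (ℚP.*-zeroˡ a))
      weighted : (w c ≡ 0ℚ) ⊎ W1≤ (μs c) (νs c) r → W1≤ (λ x → w c * μs c x) (λ y → w c * νs c y) (w c * r)
      weighted (inj₁ w≡0) = W1≤-cong (vanish w≡0 ∘ μs c) (vanish w≡0 ∘ νs c)
                                     (W1≤-mono (ℚP.≤-reflexive (vanish w≡0 r)) W1≤-zero)
      weighted (inj₂ W)   = W1≤-* (w c) (0≤w c) W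

    W1≤-mixture : ∀ {A : Set} (cs : List A) (w : A → ℚ) (νs : A → V k → ℚ) {μ ν : V k → ℚ} {r} →
                  (∀ c → 0ℚ ≤ w c) → ∑ cs w ≡ 1ℚ → (∀ y → ∑ cs (λ c → w c * νs c y) ≡ ν y) →
                  (∀ c → (w c ≡ 0ℚ) ⊎ W1≤ μ (νs c) r) → W1≤ μ ν r
    W1≤-mixture cs w νs {μ} {ν} {r} 0≤w ∑w≡1 ν≡mixture components =
      W1≤-cong μ≡mixture ν≡mixture (W1≤-mono (ℚP.≤-reflexive (by-∑w≡1 r)) (W1≤-convex cs w 0≤w components))
      where
      by-∑w≡1 : ∀ a → ∑ cs (λ c → w c * a) ≡ a
      by-∑w≡1 a = trans (∑-*ʳ cs a w) (trans (cong (_* a) ∑w≡1) (ℚP.*-identityˡ a))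
      μ≡mixture : ∀ x → ∑ cs (λ c → w c * μ x) ≡ μ x
      μ≡mixture x = by-∑w≡1 (μ x)

  recipℚ : ℚ → ℚ
  recipℚ p with ℚP.<-cmp 0ℚ p
  ... | tri< 0<p _ _ = (ℚ.1/ p) {{ℚ.>-nonZero 0<p}}
  ... | tri≈ _ _ _   = 0ℚ
  ... | tri> _ _ _   = 0ℚ

  0≤recipℚ : ∀ p → 0ℚ ≤ recipℚ p
  0≤recipℚ p with ℚP.<-cmp 0ℚ p
  ... | tri< 0<p _ _ = ℚP.<⇒≤ (ℚP.positive⁻¹ _ {{ℚP.1/pos⇒pos p {{ℚ.positive 0<p}}}})
  ... | tri≈ _ _ _   = ℚP.≤-refl
  ... | tri> _ _ _   = ℚP.≤-refl

  *-recipℚ-cancel : ∀ p a → 0ℚ ≤ p → (p ≡ 0ℚ → a ≡ 0ℚ) → a * (recipℚ p * p) ≡ a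
  *-recipℚ-cancel p a 0≤p p≡0⇒a≡0 with ℚP.<-cmp 0ℚ p
  ... | tri< 0<p _ _ = trans (cong (a *_) (ℚP.*-inverseˡ p {{ℚ.>-nonZero 0<p}})) (ℚP.*-identityʳ a)
  ... | tri≈ _ 0≡p _ rewrite p≡0⇒a≡0 (sym 0≡p) = ℚP.*-zeroˡ (0ℚ * p)
  ... | tri> _ _ p<0 = ⊥-elim (ℚP.<-irrefl refl (ℚP.<-≤-trans p<0 0≤p))

  -- The gluing lemma: couplings are composed through their common marginal ν,
  -- π x z = Σ_y A x y * B y z / ν y, the division being harmless where ν vanishes.
  module Gluing {k} {μ ν ρ : V k → ℚ} {r₁ r₂} (A : Coupling μ ν r₁) (B : Coupling ν ρ r₂) where
    open +-*-Solver using (solve; _:*_; _:=_)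
    module A = Coupling A
    module B = Coupling B

    ι : V k → ℚ
    ι y = recipℚ (ν y)

    0≤ν : ∀ y → 0ℚ ≤ ν y
    0≤ν y = subst (0ℚ ≤_) (A.marginalʳ y) (0≤∑ (allVecs q k) (λ x → A.0≤π x y))

    A-normalised : ∀ x y → A.π x y * (ι y * ν y) ≡ A.π x y
    A-normalised x y = *-recipℚ-cancel (ν y) (A.π x y) (0≤ν y)
      (λ ν≡0 → ∑V≡0⇒≡0 k (λ x → A.0≤π x y) (trans (A.marginalʳ y) ν≡0) x)

    B-normalised : ∀ y z → B.π y z * (ι y * ν y) ≡ B.π y z
    B-normalised y z = *-recipℚ-cancel (ν y) (B.π y z) (0≤ν y)
      (λ ν≡0 → ∑V≡0⇒≡0 k (λ z → B.0≤π y z) (trans (B.marginalˡ y) ν≡0) z)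

    path : V k → V k → V k → ℚ
    path x y z = A.π x y * (ι y * B.π y z)

    0≤path : ∀ x y z → 0ℚ ≤ path x y z
    0≤path x y z = 0≤* (A.0≤π x y) (0≤* (0≤recipℚ (ν y)) (B.0≤π y z))

    glued : V k → V k → ℚ
    glued x z = ∑V k (λ y → path x y z)

    glued-marginalˡ : ∀ x → ∑V k (glued x) ≡ μ x
    glued-marginalˡ x = begin
        ∑V k (λ z → ∑V k (λ y → path x y z))
      ≡⟨ ∑-swap (allVecs q k) (allVecs q k) _ ⟩
        ∑V k (λ y → ∑V k (λ z → A.π x y * (ι y * B.π y z)))
      ≡⟨ ∑V-cong k (λ y → trans (∑-*ˡ (allVecs q k) (A.π x y) _) (cong (A.π x y *_) (∑-*ˡ (allVecs q k) (ι y) _))) ⟩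
        ∑V k (λ y → A.π x y * (ι y * ∑V k (B.π y)))
      ≡⟨ ∑V-cong k (λ y → trans (cong (λ t → A.π x y * (ι y * t)) (B.marginalˡ y)) (A-normalised x y)) ⟩
        ∑V k (A.π x)
      ≡⟨ A.marginalˡ x ⟩
        μ x
      ∎
      where open ≡-Reasoning

    glued-marginalʳ : ∀ z → ∑V k (λ x → glued x z) ≡ ρ z
    glued-marginalʳ z = begin
        ∑V k (λ x → ∑V k (λ y → path x y z))
      ≡⟨ ∑-swap (allVecs q k) (allVecs q k) _ ⟩
        ∑V k (λ y → ∑V k (λ x → A.π x y * (ι y * B.π y z)))
      ≡⟨ ∑V-cong k (λ y → ∑-*ʳ (allVecs q k) _ (λ x → A.π x y)) ⟩
        ∑V k (λ y → ∑V k (λ x → A.π x y) * (ι y * B.π y z))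
      ≡⟨ ∑V-cong k (λ y → trans (cong (_* (ι y * B.π y z)) (A.marginalʳ y))
                                (trans (rearrange (ν y) (ι y) (B.π y z)) (B-normalised y z))) ⟩
        ∑V k (λ y → B.π y z)
      ≡⟨ B.marginalʳ z ⟩
        ρ z
      ∎
      where
      open ≡-Reasoning
      rearrange : ∀ a b c → a * (b * c) ≡ c * (b * a)
      rearrange = solve 3 (λ a b c → a :* (b :* c) := c :* (b :* a)) refl

    h : V k → V k → ℚ
    h x y = ⟦ ham x y ⟧

    ∑path*hamˡ : ∑V k (λ x → ∑V k (λ z → ∑V k (λ y → path x y z * h x y))) ≡ cost A.π
    ∑path*hamˡ = begin
        ∑V k (λ x → ∑V k (λ z → ∑V k (λ y → path x y z * h x y)))
      ≡⟨ ∑V-cong k (λ x → ∑-swap (allVecs q k) (allVecs q k) _) ⟩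
        ∑V k (λ x → ∑V k (λ y → ∑V k (λ z → path x y z * h x y)))
      ≡⟨ ∑V-cong k (λ x → ∑V-cong k (λ y → trans (∑V-cong k (λ z → rearrange (A.π x y) (ι y) (B.π y z) (h x y)))
           (trans (∑-*ˡ (allVecs q k) (A.π x y * h x y * ι y) _) (cong (A.π x y * h x y * ι y *_) (B.marginalˡ y))))) ⟩
        ∑V k (λ x → ∑V k (λ y → A.π x y * h x y * ι y * ν y))
      ≡⟨ ∑V-cong k (λ x → ∑V-cong k (λ y → trans (regroup (A.π x y) (h x y) (ι y) (ν y)) (cong (_* h x y) (A-normalised x y)))) ⟩
        cost A.π
      ∎
      where
      open ≡-Reasoning
      rearrange : ∀ a b c d → a * (b * c) * d ≡ a * d * b * c
      rearrange = solve 4 (λ a b c d → a :* (b :* c) :* d := a :* d :* b :* c) refl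
      regroup : ∀ a d b n → a * d * b * n ≡ a * (b * n) * d
      regroup = solve 4 (λ a d b n → a :* d :* b :* n := a :* (b :* n) :* d) refl

    ∑path*hamʳ : ∑V k (λ x → ∑V k (λ z → ∑V k (λ y → path x y z * h y z))) ≡ cost B.π
    ∑path*hamʳ = begin
        ∑V k (λ x → ∑V k (λ z → ∑V k (λ y → path x y z * h y z)))
      ≡⟨ ∑-swap (allVecs q k) (allVecs q k) _ ⟩
        ∑V k (λ z → ∑V k (λ x → ∑V k (λ y → path x y z * h y z)))
      ≡⟨ ∑V-cong k (λ z → ∑-swap (allVecs q k) (allVecs q k) _) ⟩
        ∑V k (λ z → ∑V k (λ y → ∑V k (λ x → path x y z * h y z)))
      ≡⟨ ∑-swap (allVecs q k) (allVecs q k) _ ⟩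
        ∑V k (λ y → ∑V k (λ z → ∑V k (λ x → path x y z * h y z)))
      ≡⟨ ∑V-cong k (λ y → ∑V-cong k (λ z → trans (∑V-cong k (λ x → rearrange (A.π x y) (ι y) (B.π y z) (h y z)))
           (trans (∑-*ʳ (allVecs q k) (ι y * B.π y z * h y z) _) (cong (_* (ι y * B.π y z * h y z)) (A.marginalʳ y))))) ⟩
        ∑V k (λ y → ∑V k (λ z → ν y * (ι y * B.π y z * h y z)))
      ≡⟨ ∑V-cong k (λ y → ∑V-cong k (λ z → trans (regroup (ν y) (ι y) (B.π y z) (h y z)) (cong (_* h y z) (B-normalised y z)))) ⟩
        cost B.π
      ∎
      where
      open ≡-Reasoning
      rearrange : ∀ a b c d → a * (b * c) * d ≡ a * (b * c * d)
      rearrange = solve 4 (λ a b c d → a :* (b :* c) :* d := a :* (b :* c :* d)) refl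
      regroup : ∀ n b c d → n * (b * c * d) ≡ c * (b * n) * d
      regroup = solve 4 (λ n b c d → n :* (b :* c :* d) := c :* (b :* n) :* d) refl

    cost-glued≤ : cost glued ≤ r₁ + r₂
    cost-glued≤ = begin
        cost glued
      ≡⟨ ∑V-cong k (λ x → ∑V-cong k (λ z → sym (∑-*ʳ (allVecs q k) (h x z) (λ y → path x y z)))) ⟩
        ∑V k (λ x → ∑V k (λ z → ∑V k (λ y → path x y z * h x z)))
      ≤⟨ ∑-mono-≤ (allVecs q k) (λ x → ∑-mono-≤ (allVecs q k) (λ z → ∑-mono-≤ (allVecs q k) (λ y → triangle x y z))) ⟩
        ∑V k (λ x → ∑V k (λ z → ∑V k (λ y → path x y z * h x y + path x y z * h y z)))
      ≡⟨ trans (∑V-cong k (λ x → trans (∑V-cong k (λ z → ∑-+ (allVecs q k) _ _)) (∑-+ (allVecs q k) _ _))) (∑-+ (allVecs q k) _ _) ⟩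
        ∑V k (λ x → ∑V k (λ z → ∑V k (λ y → path x y z * h x y))) + ∑V k (λ x → ∑V k (λ z → ∑V k (λ y → path x y z * h y z)))
      ≡⟨ cong₂ _+_ ∑path*hamˡ ∑path*hamʳ ⟩
        cost A.π + cost B.π
      ≤⟨ ℚP.+-mono-≤ A.cost≤ B.cost≤ ⟩
        r₁ + r₂
      ∎
      where
      open ℚP.≤-Reasoning
      triangle : ∀ x y z → path x y z * h x z ≤ path x y z * h x y + path x y z * h y z
      triangle x y z = ℚP.≤-trans
        (ℚP.*-monoˡ-≤-nonNeg (path x y z) {{ℚ.nonNegative (0≤path x y z)}}
          (ℚP.≤-trans (⟦⟧-mono-≤ (ham-triangle x y z)) (ℚP.≤-reflexive (⟦⟧-+ (ham x y) (ham y z)))))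
        (ℚP.≤-reflexive (ℚP.*-distribˡ-+ (path x y z) (h x y) (h y z)))

  W1≤-trans : ∀ {k} {μ ν ρ : V k → ℚ} {r₁ r₂} → W1≤ μ ν r₁ → W1≤ ν ρ r₂ → W1≤ μ ρ (r₁ + r₂)
  W1≤-trans {k} W₁ W₂ = W1≤-coupling (record
    { π = glued ; 0≤π = λ x z → 0≤∑ (allVecs q k) (λ y → 0≤path x y z)
    ; marginalˡ = glued-marginalˡ ; marginalʳ = glued-marginalʳ ; cost≤ = cost-glued≤ })
    where open Gluing (coupling W₁) (coupling W₂)

module Uniform (q : ℕ) where
  open import Data.Rational using (_≤_)
  open Rationals
  open Sums
  open SumsOverVectors q
  open Couplings q

  size : ∀ k {Q : V k → Set} → (∀ τ → Dec (Q τ)) → ℕ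
  size k Q? = length (filter Q? (allVecs q k))

  uniform : ∀ {k} {Q : V k → Set} → (∀ τ → Dec (Q τ)) → V k → ℚ
  uniform {k} Q? τ = when (Q? τ) (recip (size k Q?))

  module _ {k : ℕ} {Q : V k → Set} (Q? : ∀ τ → Dec (Q τ)) where

    ⟦size⟧ : ⟦ size k Q? ⟧ ≡ ∑V k (λ τ → when (Q? τ) 1ℚ)
    ⟦size⟧ = ⟦length-filter⟧ Q? (allVecs q k)

    0≤uniform : ∀ τ → 0ℚ ≤ uniform Q? τ
    0≤uniform τ = 0≤when (Q? τ) (0≤recip (size k Q?))

    ∑-uniform : ∑V k (uniform Q?) ≡ ⟦ size k Q? ⟧ * recip (size k Q?)
    ∑-uniform = begin
        ∑V k (λ τ → when (Q? τ) (recip (size k Q?)))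
      ≡⟨ ∑V-cong k (λ τ → trans (cong (when (Q? τ)) (sym (ℚP.*-identityˡ _))) (sym (when-*ˡ (Q? τ) 1ℚ _))) ⟩
        ∑V k (λ τ → when (Q? τ) 1ℚ * recip (size k Q?))
      ≡⟨ ∑-*ʳ (allVecs q k) _ _ ⟩
        ∑V k (λ τ → when (Q? τ) 1ℚ) * recip (size k Q?)
      ≡⟨ cong (_* recip (size k Q?)) (sym ⟦size⟧) ⟩
        ⟦ size k Q? ⟧ * recip (size k Q?)
      ∎
      where open ≡-Reasoning

    ∑-uniform≤1 : ∑V k (uniform Q?) ≤ 1ℚ
    ∑-uniform≤1 = subst (_≤ 1ℚ) (sym ∑-uniform) (⟦⟧*recip≤1 (size k Q?))

    ∑-uniform≡1 : size k Q? ≢ 0 → ∑V k (uniform Q?) ≡ 1ℚ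
    ∑-uniform≡1 size≢0 = trans ∑-uniform (⟦⟧*recip≡1 size≢0)

    witness⇒size≢0 : ∀ τ → Q τ → size k Q? ≢ 0
    witness⇒size≢0 τ Qτ size≡0 = ℚP.1≢0 (trans (sym (when-yes (Q? τ) 1ℚ Qτ))
      (∑V≡0⇒≡0 k (λ τ → 0≤when (Q? τ) (ℚP.≤ᵇ⇒≤ _)) (trans (sym ⟦size⟧) (cong ⟦_⟧ size≡0)) τ))

    uniform-empty : size k Q? ≡ 0 → ∀ τ → uniform Q? τ ≡ 0ℚ
    uniform-empty size≡0 τ = trans (cong (when (Q? τ) ∘ recip) size≡0) (when-zero (Q? τ))

    ∑-uniform-empty : size k Q? ≡ 0 → ∑V k (uniform Q?) ≡ 0ℚ
    ∑-uniform-empty size≡0 = trans (∑V-cong k (uniform-empty size≡0)) (∑-zero (allVecs q k))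

    size≢0⇒witness : size k Q? ≢ 0 → Σ (V k) Q
    size≢0⇒witness = filter-nonempty Q? (allVecs q k)

  module _ {k : ℕ} {Q R : V k → Set} (Q? : ∀ τ → Dec (Q τ)) (R? : ∀ τ → Dec (R τ))
           (Q⇒R : ∀ τ → Q τ → R τ) (R⇒Q : ∀ τ → R τ → Q τ) where

    size-cong : size k Q? ≡ size k R?
    size-cong = ⟦⟧-injective (trans (⟦size⟧ Q?)
      (trans (∑V-cong k (λ τ → when-cong (Q? τ) (R? τ) 1ℚ (Q⇒R τ) (R⇒Q τ))) (sym (⟦size⟧ R?))))

    uniform-cong : ∀ τ → uniform Q? τ ≡ uniform R? τ
    uniform-cong τ rewrite size-cong = when-cong (Q? τ) (R? τ) _ (Q⇒R τ) (R⇒Q τ)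

  module Pinned {k : ℕ} (p : Fin (suc k)) (b : Fin q) {Q : V (suc k) → Set} (Q? : ∀ σ → Dec (Q σ))
                (Q⇒pinned : ∀ σ → Q σ → lookup σ p ≡ b) where

    Q?-at : ∀ ρ → Dec (Q (insertAt ρ p b))
    Q?-at ρ = Q? (insertAt ρ p b)

    size-pinned : size (suc k) Q? ≡ size k Q?-at
    size-pinned = ⟦⟧-injective (trans (⟦size⟧ Q?) (trans (∑V-when-pinned k p b Q? Q⇒pinned (λ _ → 1ℚ)) (sym (⟦size⟧ Q?-at))))

    uniform-pinned : ∀ σ → uniform Q? σ ≡ fixAt p b (uniform Q?-at) σ
    uniform-pinned σ rewrite size-pinned = restrict (lookup σ p ≟ b)
      where
      restrict : (d : Dec (lookup σ p ≡ b)) → when (Q? σ) (recip (size k Q?-at))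
                                            ≡ when d (when (Q?-at (removeAt σ p)) (recip (size k Q?-at)))
      restrict (yes σp≡b) = when-cong (Q? σ) (Q?-at (removeAt σ p)) _ (subst Q (sym σ≡)) (subst Q σ≡)
        where
        σ≡ : insertAt (removeAt σ p) p b ≡ σ
        σ≡ = trans (cong (insertAt (removeAt σ p) p) (sym σp≡b)) (VecP.insertAt-removeAt σ p)
      restrict (no σp≢b)  = when-no (Q? σ) _ (σp≢b ∘ Q⇒pinned σ)

    -- The left-hand side is the defining expression of condMarg.
    marginal-pinned : ∀ τ → ratio (length (filter (λ σ → removeAt σ p ≟ᵛ τ) (filter Q? (allVecs q (suc k)))))
                                  (length (filter Q? (allVecs q (suc k))))
                            ≡ uniform Q?-at τ
    marginal-pinned τ = trans (cong₂ ratio count-τ size-pinned) (ratio-𝟙 (Q?-at τ) (size k Q?-at))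
      where
      open ≡-Reasoning
      ratio-𝟙 : ∀ {P : Set} (d : Dec P) t → ratio (Counting.𝟙 d) t ≡ when d (recip t)
      ratio-𝟙 (yes _) zero    = refl
      ratio-𝟙 (yes _) (suc t) = refl
      ratio-𝟙 (no _)  t       = ratio-zeroˡ t
      ⟦𝟙⟧ : ∀ {P : Set} (d : Dec P) → when d 1ℚ ≡ ⟦ Counting.𝟙 d ⟧
      ⟦𝟙⟧ (yes _) = refl
      ⟦𝟙⟧ (no _)  = refl
      count-τ : length (filter (λ σ → removeAt σ p ≟ᵛ τ) (filter Q? (allVecs q (suc k)))) ≡ Counting.𝟙 (Q?-at τ)
      count-τ = ⟦⟧-injective (begin
          ⟦ length (filter (λ σ → removeAt σ p ≟ᵛ τ) (filter Q? (allVecs q (suc k)))) ⟧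
        ≡⟨ ⟦length-filter⟧ (λ σ → removeAt σ p ≟ᵛ τ) (filter Q? (allVecs q (suc k))) ⟩
          ∑ (filter Q? (allVecs q (suc k))) (λ σ → when (removeAt σ p ≟ᵛ τ) 1ℚ)
        ≡⟨ ∑-filter Q? (allVecs q (suc k)) _ ⟩
          ∑V (suc k) (λ σ → when (Q? σ) (when (removeAt σ p ≟ᵛ τ) 1ℚ))
        ≡⟨ ∑V-when-pinned k p b Q? Q⇒pinned _ ⟩
          ∑V k (λ ρ → when (Q?-at ρ) (when (removeAt (insertAt ρ p b) p ≟ᵛ τ) 1ℚ))
        ≡⟨ ∑V-cong k (λ ρ → trans (cong (λ ρ′ → when (Q?-at ρ) (when (ρ′ ≟ᵛ τ) 1ℚ)) (VecP.removeAt-insertAt ρ p b))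
                                  (when-swap (Q?-at ρ) (ρ ≟ᵛ τ) 1ℚ)) ⟩
          ∑V k (λ ρ → when (ρ ≟ᵛ τ) (when (Q?-at ρ) 1ℚ))
        ≡⟨ ∑V-select k τ (λ ρ → when (Q?-at ρ) 1ℚ) ⟩
          when (Q?-at τ) 1ℚ
        ≡⟨ ⟦𝟙⟧ (Q?-at τ) ⟩
          ⟦ Counting.𝟙 (Q?-at τ) ⟧
        ∎)

  module ByValue {k : ℕ} {Q : V k → Set} (Q? : ∀ τ → Dec (Q τ)) (f : V k → Fin q) where

    Q?-with : ∀ c τ → Dec (Q τ × f τ ≡ c)
    Q?-with c τ = Q? τ ×-dec (f τ ≟ c)

    weight : Fin q → ℚ
    weight c = ⟦ size k (Q?-with c) ⟧ * recip (size k Q?)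

    0≤weight : ∀ c → 0ℚ ≤ weight c
    0≤weight c = 0≤* (0≤⟦⟧ (size k (Q?-with c))) (0≤recip (size k Q?))

    weight≡0 : ∀ c → size k (Q?-with c) ≡ 0 → weight c ≡ 0ℚ
    weight≡0 c size≡0 = trans (cong (λ n → ⟦ n ⟧ * recip (size k Q?)) size≡0) (ℚP.*-zeroˡ (recip (size k Q?)))

    ∑-when-with : ∀ τ a → ∑ (allFin q) (λ c → when (Q?-with c τ) a) ≡ when (Q? τ) a
    ∑-when-with τ a = begin
        ∑ (allFin q) (λ c → when (Q?-with c τ) a)
      ≡⟨ ∑-cong (allFin q) (λ c → trans (when-×-dec (Q? τ) (f τ ≟ c) a)
                                        (cong (when (Q? τ)) (when-cong (f τ ≟ c) (c ≟ f τ) a sym sym))) ⟩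
        ∑ (allFin q) (λ c → when (Q? τ) (when (c ≟ f τ) a))
      ≡⟨ ∑-when (allFin q) (Q? τ) _ ⟩
        when (Q? τ) (∑ (allFin q) (λ c → when (c ≟ f τ) a))
      ≡⟨ cong (when (Q? τ)) (∑-select q (f τ) (λ _ → a)) ⟩
        when (Q? τ) a
      ∎
      where open ≡-Reasoning

    ∑-weight : size k Q? ≢ 0 → ∑ (allFin q) weight ≡ 1ℚ
    ∑-weight size≢0 = begin
        ∑ (allFin q) (λ c → ⟦ size k (Q?-with c) ⟧ * recip (size k Q?))
      ≡⟨ ∑-*ʳ (allFin q) _ (λ c → ⟦ size k (Q?-with c) ⟧) ⟩
        ∑ (allFin q) (λ c → ⟦ size k (Q?-with c) ⟧) * recip (size k Q?)
      ≡⟨ cong (_* recip (size k Q?)) sizes ⟩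
        ⟦ size k Q? ⟧ * recip (size k Q?)
      ≡⟨ ⟦⟧*recip≡1 size≢0 ⟩
        1ℚ
      ∎
      where
      open ≡-Reasoning
      sizes : ∑ (allFin q) (λ c → ⟦ size k (Q?-with c) ⟧) ≡ ⟦ size k Q? ⟧
      sizes = trans (∑-cong (allFin q) (λ c → ⟦size⟧ (Q?-with c)))
              (trans (∑-swap (allFin q) (allVecs q k) _)
              (trans (∑V-cong k (λ τ → ∑-when-with τ 1ℚ)) (sym (⟦size⟧ Q?))))

    uniform≡mixture : ∀ τ → ∑ (allFin q) (λ c → weight c * uniform (Q?-with c) τ) ≡ uniform Q? τ
    uniform≡mixture τ = trans (∑-cong (allFin q) component) (∑-when-with τ (recip (size k Q?)))
      where
      component : ∀ c → weight c * uniform (Q?-with c) τ ≡ when (Q?-with c τ) (recip (size k Q?))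
      component c with Q?-with c τ
      ... | no _  = ℚP.*-zeroʳ (weight c)
      ... | yes Qτ = begin
          ⟦ n ⟧ * recip (size k Q?) * recip n
        ≡⟨ ℚP.*-assoc ⟦ n ⟧ _ _ ⟩
          ⟦ n ⟧ * (recip (size k Q?) * recip n)
        ≡⟨ cong (⟦ n ⟧ *_) (ℚP.*-comm (recip (size k Q?)) (recip n)) ⟩
          ⟦ n ⟧ * (recip n * recip (size k Q?))
        ≡⟨ sym (ℚP.*-assoc ⟦ n ⟧ _ _) ⟩
          ⟦ n ⟧ * recip n * recip (size k Q?)
        ≡⟨ cong (_* recip (size k Q?)) (⟦⟧*recip≡1 (witness⇒size≢0 (Q?-with c) τ Qτ)) ⟩
          1ℚ * recip (size k Q?)
        ≡⟨ ℚP.*-identityˡ _ ⟩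
          recip (size k Q?)
        ∎
        where
        open ≡-Reasoning
        n : ℕ
        n = size k (Q?-with c)

module GraphFacts (G : Graph) where
  open import Data.Nat using (_≤_; _<_)
  open Graph G
  open Counting

  Meet : Fin nE → Fin nE → Set
  Meet e f = Σ (Fin nV) λ x → Inc e x × Inc f x

  adj⇒meet : ∀ {e f} → Adj e f → Meet e f
  adj⇒meet {e} (_ , inj₁ f∋x) = proj₁ (ends e) , inj₁ refl , f∋x
  adj⇒meet {e} (_ , inj₂ f∋x) = proj₂ (ends e) , inj₂ refl , f∋x

  meet⇒adj : ∀ {e f} → e ≢ f → Meet e f → Adj e f
  meet⇒adj e≢f (x , inj₁ refl , f∋x) = e≢f , inj₁ f∋x
  meet⇒adj e≢f (x , inj₂ refl , f∋x) = e≢f , inj₂ f∋x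

  adj-sym : ∀ {e f} → Adj e f → Adj f e
  adj-sym adj@(e≢f , _) with adj⇒meet adj
  ... | x , e∋x , f∋x = meet⇒adj (e≢f ∘ sym) (x , f∋x , e∋x)

  endpoints : ∀ {e x y z} → Inc e x → Inc e y → x ≢ y → Inc e z → (z ≡ x) ⊎ (z ≡ y)
  endpoints (inj₁ refl) (inj₁ refl) x≢y _           = ⊥-elim (x≢y refl)
  endpoints (inj₁ refl) (inj₂ refl) x≢y (inj₁ refl) = inj₁ refl
  endpoints (inj₁ refl) (inj₂ refl) x≢y (inj₂ refl) = inj₂ refl
  endpoints (inj₂ refl) (inj₁ refl) x≢y (inj₁ refl) = inj₂ refl
  endpoints (inj₂ refl) (inj₁ refl) x≢y (inj₂ refl) = inj₁ refl
  endpoints (inj₂ refl) (inj₂ refl) x≢y _           = ⊥-elim (x≢y refl)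

  other-endpoint : ∀ {e x} → Inc e x → Σ (Fin nV) λ y → Inc e y × y ≢ x
  other-endpoint {e} (inj₁ refl) = proj₂ (ends e) , inj₂ refl , loopless e ∘ sym
  other-endpoint {e} (inj₂ refl) = proj₁ (ends e) , inj₁ refl , loopless e

  same-endpoints⇒≡ : ∀ {e f x y} → x ≢ y → Inc e x → Inc e y → Inc f x → Inc f y → e ≡ f
  same-endpoints⇒≡ {e} {f} x≢y e∋x e∋y f∋x f∋y = simple e f (f⇒e (inj₁ refl)) (f⇒e (inj₂ refl))
    where
    f⇒e : ∀ {z} → Inc f z → Inc e z
    f⇒e f∋z with endpoints f∋x f∋y x≢y f∋z
    ... | inj₁ refl = e∋x
    ... | inj₂ refl = e∋y

  vdeg≡count : ∀ x → vdeg x ≡ count (λ e → Inc? e x)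
  vdeg≡count x = length-filter-tabulate (λ e → Inc? e x) nE (λ e → e)

  edeg≡count : ∀ e → edeg e ≡ count (Adj? e)
  edeg≡count e = length-filter-tabulate (Adj? e) nE (λ f → f)

  vdeg≡1⇒unique : ∀ {x e f} → vdeg x ≡ 1 → Inc e x → Inc f x → e ≡ f
  vdeg≡1⇒unique {x} {e} {f} deg≡1 e∋x f∋x with e ≟ f
  ... | yes e≡f = e≡f
  ... | no e≢f  = ⊥-elim (ℕP.<-irrefl refl (ℕP.≤-trans (2≤count (λ e → Inc? e x) e≢f e∋x f∋x)
                                                        (ℕP.≤-reflexive (trans (sym (vdeg≡count x)) deg≡1))))

if?_then_else_ : ∀ {P A : Set} → Dec P → A → A → A
if? yes _ then a else b = a
if? no _  then a else b = b

Incident : ∀ {nV nE} → (Fin nE → Fin nV × Fin nV) → Fin nE → Fin nV → Set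
Incident ends e x = (x ≡ proj₁ (ends e)) ⊎ (x ≡ proj₂ (ends e))

-- Instances with at least two edges, given by their components so that nE = 2 + m holds definitionally.
module Configuration
  {nV m : ℕ} (ends : Fin (suc (suc m)) → Fin nV × Fin nV) (loopless : ∀ e → proj₁ (ends e) ≢ proj₂ (ends e))
  (simple : ∀ e f → Incident ends e (proj₁ (ends f)) → Incident ends e (proj₂ (ends f)) → e ≡ f)
  (q : ℕ) (L : Fin (suc (suc m)) → Subset q) where
  open import Data.Nat using (_≤_)
  open Counting
  open Rationals using (ListCond-transfer)

  G : Graph
  G = record { nV = nV ; nE = suc (suc m) ; ends = ends ; loopless = loopless ; simple = simple }

  I : Instance
  I = record { G = G ; q = q ; L = L }

  open Instance I using (Inc; Inc?; Adj; Adj?; vdeg; edeg; Proper; Proper?; MaxDegLe)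
  open GraphFacts G

  module Pendant (i : Fin (suc (suc m))) {u v : Fin nV} (i∋u : Inc i u) (i∋v : Inc i v) (u≢v : u ≢ v)
                 (deg-u≡1 : vdeg u ≡ 1) (j : Fin (suc (suc m))) (j∋v : Inc j v) (j≢i : j ≢ i) where
    open Rationals using (⟦⟧-+)
    open Sums using (when; when-zero)
    open Sums.SumsOverVectors q using (∑V)
    open Couplings q
    open Uniform q
    open Hamming

    i≢j : i ≢ j
    i≢j = j≢i ∘ sym

    edge-at-u≡i : ∀ e → Inc e u → e ≡ i
    edge-at-u≡i e e∋u = vdeg≡1⇒unique deg-u≡1 e∋u i∋u

    j′ : Fin (suc m)
    j′ = punchOut i≢j

    punchIn-j′ : punchIn i j′ ≡ j
    punchIn-j′ = FP.punchIn-punchOut i≢j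

    rest : Fin m → Fin (suc (suc m))
    rest k = punchIn i (punchIn j′ k)

    rest≢i : ∀ k → rest k ≢ i
    rest≢i k = FP.punchInᵢ≢i i _

    rest≢j : ∀ k → rest k ≢ j
    rest≢j k rest≡j = FP.punchInᵢ≢i j′ k (FP.punchIn-injective i _ _ (trans rest≡j (sym punchIn-j′)))

    rest-injective : ∀ {k l} → rest k ≡ rest l → k ≡ l
    rest-injective eq = FP.punchIn-injective j′ _ _ (FP.punchIn-injective i _ _ eq)

    edge-cases : ∀ e → (e ≡ i) ⊎ ((e ≡ j) ⊎ Σ (Fin m) (λ k → e ≡ rest k))
    edge-cases e with e ≟ i
    ... | yes e≡i = inj₁ e≡i
    ... | no e≢i with punchOut (e≢i ∘ sym) ≟ j′
    ...   | yes e′≡j′ = inj₂ (inj₁ (trans (sym (FP.punchIn-punchOut (e≢i ∘ sym)))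
                                         (trans (cong (punchIn i) e′≡j′) punchIn-j′)))
    ...   | no e′≢j′  = inj₂ (inj₂ (punchOut (e′≢j′ ∘ sym) ,
                        trans (sym (FP.punchIn-punchOut (e≢i ∘ sym)))
                              (cong (punchIn i) (sym (FP.punchIn-punchOut (e′≢j′ ∘ sym))))))

    rest-∌u : ∀ k → ¬ Inc (rest k) u
    rest-∌u k rest∋u = rest≢i k (edge-at-u≡i (rest k) rest∋u)

    w : Fin nV
    w = proj₁ (other-endpoint j∋v)

    j∋w : Inc j w
    j∋w = proj₁ (proj₂ (other-endpoint j∋v))

    w≢v : w ≢ v
    w≢v = proj₂ (proj₂ (other-endpoint j∋v))

    u≢w : u ≢ w
    u≢w u≡w = j≢i (edge-at-u≡i j (subst (Inc j) (sym u≡w) j∋w))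

    i-endpoints : ∀ {z} → Inc i z → (z ≡ u) ⊎ (z ≡ v)
    i-endpoints = endpoints i∋u i∋v u≢v

    j-endpoints : ∀ {z} → Inc j z → (z ≡ v) ⊎ (z ≡ w)
    j-endpoints = endpoints j∋v j∋w (w≢v ∘ sym)

    AtJ : Fin m → Set
    AtJ k = Inc (rest k) v ⊎ Inc (rest k) w

    AtJ? : ∀ k → Dec (AtJ k)
    AtJ? k = Inc? (rest k) v ⊎-dec Inc? (rest k) w

    adj-i-rest : ∀ k → Inc (rest k) v → Adj i (rest k)
    adj-i-rest k rest∋v = meet⇒adj (rest≢i k ∘ sym) (v , i∋v , rest∋v)

    adj-j-rest : ∀ k → AtJ k → Adj j (rest k)
    adj-j-rest k (inj₁ rest∋v) = meet⇒adj (rest≢j k ∘ sym) (v , j∋v , rest∋v)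
    adj-j-rest k (inj₂ rest∋w) = meet⇒adj (rest≢j k ∘ sym) (w , j∋w , rest∋w)

    rest-∌v∧w : ∀ k → Inc (rest k) v → Inc (rest k) w → ⊥
    rest-∌v∧w k rest∋v rest∋w = rest≢j k (same-endpoints⇒≡ (w≢v ∘ sym) rest∋v rest∋w j∋v j∋w)

    at-v : ∀ k {z} → Inc i z → Inc (rest k) z → Inc (rest k) v
    at-v k i∋z rest∋z with i-endpoints i∋z
    ... | inj₁ refl = ⊥-elim (rest-∌u k rest∋z)
    ... | inj₂ refl = rest∋z

    count-split : ∀ {P : Fin (suc (suc m)) → Set} (P? : ∀ e → Dec (P e)) →
                  count P? ≡ 𝟙 (P? i) ℕ.+ (𝟙 (P? j) ℕ.+ count (P? ∘ rest))
    count-split P? = trans (count-punchIn P? i) (cong (𝟙 (P? i) ℕ.+_)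
      (trans (count-punchIn (P? ∘ punchIn i) j′) (cong (λ e → 𝟙 (P? e) ℕ.+ count (P? ∘ rest)) punchIn-j′)))

    vdeg-split : ∀ x → vdeg x ≡ 𝟙 (Inc? i x) ℕ.+ (𝟙 (Inc? j x) ℕ.+ count (λ k → Inc? (rest k) x))
    vdeg-split x = trans (vdeg≡count x) (count-split (λ e → Inc? e x))

    edeg-split : ∀ e → edeg e ≡ 𝟙 (Adj? e i) ℕ.+ (𝟙 (Adj? e j) ℕ.+ count (λ l → Adj? e (rest l)))
    edeg-split e = trans (edeg≡count e) (count-split (Adj? e))

    assemble : Fin q → Fin q → Vec (Fin q) m → Vec (Fin q) (suc (suc m))
    assemble x y ρ = insertAt (insertAt ρ j′ y) i x

    assemble-i : ∀ x y ρ → lookup (assemble x y ρ) i ≡ x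
    assemble-i x y ρ = VecP.insertAt-lookup (insertAt ρ j′ y) i x

    lookup-j : ∀ (τ : Vec (Fin q) (suc m)) x → lookup (insertAt τ i x) j ≡ lookup τ j′
    lookup-j τ x = trans (cong (lookup (insertAt τ i x)) (sym punchIn-j′)) (VecP.insertAt-punchIn τ i x j′)

    assemble-j : ∀ x y ρ → lookup (assemble x y ρ) j ≡ y
    assemble-j x y ρ = trans (lookup-j (insertAt ρ j′ y) x) (VecP.insertAt-lookup ρ j′ y)

    assemble-rest : ∀ x y ρ k → lookup (assemble x y ρ) (rest k) ≡ lookup ρ k
    assemble-rest x y ρ k =
      trans (VecP.insertAt-punchIn (insertAt ρ j′ y) i x (punchIn j′ k)) (VecP.insertAt-punchIn ρ j′ y k)

    -- The list of i is made unrestricted so that the laws with i ← c make sense also for c ∉ L i,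
    -- as needed in the intermediate step of part (2).
    L⁺ : Fin (suc (suc m)) → Subset q
    L⁺ e = if? e ≟ i then S.⊤ else L e

    I⁺ : Instance
    I⁺ = record { G = G ; q = q ; L = L⁺ }

    Proper⁺ : Vec (Fin q) (suc (suc m)) → Set
    Proper⁺ = Instance.Proper I⁺

    -- Opaque, because unfolding this decision procedure during conversion checking is very costly.
    opaque
      Proper⁺? : ∀ τ → Dec (Proper⁺ τ)
      Proper⁺? = Instance.Proper? I⁺

    L⁺-≢i : ∀ {e c} → e ≢ i → c ∈ L⁺ e → c ∈ L e
    L⁺-≢i {e} e≢i c∈L⁺e with e ≟ i
    ... | yes e≡i = ⊥-elim (e≢i e≡i)
    ... | no _    = c∈L⁺e

    L-≢i : ∀ {e c} → e ≢ i → c ∈ L e → c ∈ L⁺ e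
    L-≢i {e} e≢i c∈Le with e ≟ i
    ... | yes e≡i = ⊥-elim (e≢i e≡i)
    ... | no _    = c∈Le

    L⁺-i : ∀ {c} → c ∈ L⁺ i
    L⁺-i with i ≟ i
    ... | yes _  = SP.∈⊤
    ... | no i≢i = ⊥-elim (i≢i refl)

    Proper⇒Proper⁺ : ∀ {τ} → Proper τ → Proper⁺ τ
    Proper⇒Proper⁺ {τ} (in-lists , distinct) = in-lists⁺ , distinct
      where
      in-lists⁺ : ∀ e → lookup τ e ∈ L⁺ e
      in-lists⁺ e with e ≟ i
      ... | yes _ = SP.∈⊤
      ... | no _  = in-lists e

    Proper⁺⇒Proper : ∀ {τ} → lookup τ i ∈ L i → Proper⁺ τ → Proper τ
    Proper⁺⇒Proper {τ} τi∈Li (in-lists⁺ , distinct) = in-lists , distinct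
      where
      in-lists : ∀ e → lookup τ e ∈ L e
      in-lists e with e ≟ i
      ... | yes refl = τi∈Li
      ... | no e≢i   = L⁺-≢i e≢i (in-lists⁺ e)

    record Compatible (x y : Fin q) (ρ : Vec (Fin q) m) : Set where
      field
        y∈Lj     : y ∈ L j
        ρ∈L      : ∀ k → lookup ρ k ∈ L (rest k)
        x≢y      : x ≢ y
        x≢ρ      : ∀ k → Inc (rest k) v → x ≢ lookup ρ k
        y≢ρ      : ∀ k → AtJ k → y ≢ lookup ρ k
        ρ-proper : ∀ k l → Adj (rest k) (rest l) → lookup ρ k ≢ lookup ρ l

    Proper⁺⇒Compatible : ∀ {x y ρ} → Proper⁺ (assemble x y ρ) → Compatible x y ρ
    Proper⁺⇒Compatible {x} {y} {ρ} (in-lists , distinct) = record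
      { y∈Lj     = subst (_∈ L j) (assemble-j x y ρ) (L⁺-≢i j≢i (in-lists j))
      ; ρ∈L      = λ k → subst (_∈ L (rest k)) (assemble-rest x y ρ k) (L⁺-≢i (rest≢i k) (in-lists (rest k)))
      ; x≢y      = λ x≡y → distinct i j (meet⇒adj i≢j (v , i∋v , j∋v)) (≡-at i j (assemble-i x y ρ) (assemble-j x y ρ) x≡y)
      ; x≢ρ      = λ k rest∋v x≡ρk → distinct i (rest k) (adj-i-rest k rest∋v)
                                       (≡-at i (rest k) (assemble-i x y ρ) (assemble-rest x y ρ k) x≡ρk)
      ; y≢ρ      = λ k atJ y≡ρk → distinct j (rest k) (adj-j-rest k atJ)
                                    (≡-at j (rest k) (assemble-j x y ρ) (assemble-rest x y ρ k) y≡ρk)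
      ; ρ-proper = λ k l adj ρk≡ρl → distinct (rest k) (rest l) adj
                                       (≡-at (rest k) (rest l) (assemble-rest x y ρ k) (assemble-rest x y ρ l) ρk≡ρl)
      }
      where
      ≡-at : ∀ e f {a b} → lookup (assemble x y ρ) e ≡ a → lookup (assemble x y ρ) f ≡ b → a ≡ b →
             lookup (assemble x y ρ) e ≡ lookup (assemble x y ρ) f
      ≡-at e f τe≡a τf≡b a≡b = trans τe≡a (trans a≡b (sym τf≡b))

    Compatible⇒Proper⁺ : ∀ {x y ρ} → Compatible x y ρ → Proper⁺ (assemble x y ρ)
    Compatible⇒Proper⁺ {x} {y} {ρ} C = in-lists , distinct
      where
      open Compatible C
      τ : Vec (Fin q) (suc (suc m))
      τ = assemble x y ρ
      in-lists : ∀ e → lookup τ e ∈ L⁺ e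
      in-lists e with edge-cases e
      ... | inj₁ refl              = L⁺-i
      ... | inj₂ (inj₁ refl)       = L-≢i j≢i (subst (_∈ L j) (sym (assemble-j x y ρ)) y∈Lj)
      ... | inj₂ (inj₂ (k , refl)) = L-≢i (rest≢i k) (subst (_∈ L (rest k)) (sym (assemble-rest x y ρ k)) (ρ∈L k))
      x≢ρ-adj : ∀ k → Adj i (rest k) → x ≢ lookup ρ k
      x≢ρ-adj k adj with adj⇒meet adj
      ... | z , i∋z , rest∋z with i-endpoints i∋z
      ...   | inj₁ refl = ⊥-elim (rest-∌u k rest∋z)
      ...   | inj₂ refl = x≢ρ k rest∋z
      y≢ρ-adj : ∀ k → Adj j (rest k) → y ≢ lookup ρ k
      y≢ρ-adj k adj with adj⇒meet adj
      ... | z , j∋z , rest∋z with j-endpoints j∋z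
      ...   | inj₁ refl = y≢ρ k (inj₁ rest∋z)
      ...   | inj₂ refl = y≢ρ k (inj₂ rest∋z)
      apart : ∀ {e f a b} → lookup τ e ≡ a → lookup τ f ≡ b → a ≢ b → lookup τ e ≢ lookup τ f
      apart τe≡a τf≡b a≢b τe≡τf = a≢b (trans (sym τe≡a) (trans τe≡τf τf≡b))
      τi : lookup τ i ≡ x
      τi = assemble-i x y ρ
      τj : lookup τ j ≡ y
      τj = assemble-j x y ρ
      τr : ∀ k → lookup τ (rest k) ≡ lookup ρ k
      τr = assemble-rest x y ρ
      distinct : ∀ e f → Adj e f → lookup τ e ≢ lookup τ f
      distinct e f adj with edge-cases e | edge-cases f
      ... | inj₁ refl              | inj₁ refl              = ⊥-elim (proj₁ adj refl)
      ... | inj₁ refl              | inj₂ (inj₁ refl)       = apart τi τj x≢y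
      ... | inj₁ refl              | inj₂ (inj₂ (l , refl)) = apart τi (τr l) (x≢ρ-adj l adj)
      ... | inj₂ (inj₁ refl)       | inj₁ refl              = apart τj τi (x≢y ∘ sym)
      ... | inj₂ (inj₁ refl)       | inj₂ (inj₁ refl)       = ⊥-elim (proj₁ adj refl)
      ... | inj₂ (inj₁ refl)       | inj₂ (inj₂ (l , refl)) = apart τj (τr l) (y≢ρ-adj l adj)
      ... | inj₂ (inj₂ (k , refl)) | inj₁ refl              = apart (τr k) τi (x≢ρ-adj k (adj-sym adj) ∘ sym)
      ... | inj₂ (inj₂ (k , refl)) | inj₂ (inj₁ refl)       = apart (τr k) τj (y≢ρ-adj k (adj-sym adj) ∘ sym)
      ... | inj₂ (inj₂ (k , refl)) | inj₂ (inj₂ (l , refl)) = apart (τr k) (τr l) (ρ-proper k l adj)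

    Fixed₁? : ∀ x τ → Dec (Proper⁺ (insertAt τ i x))
    Fixed₁? x τ = Proper⁺? (insertAt τ i x)

    Fixed₂? : ∀ x y τ → Dec (Proper⁺ (insertAt τ i x) × lookup τ j′ ≡ y)
    Fixed₂? x y τ = Fixed₁? x τ ×-dec (lookup τ j′ ≟ y)

    Rest? : ∀ x y ρ → Dec (Proper⁺ (assemble x y ρ))
    Rest? x y ρ = Proper⁺? (assemble x y ρ)

    condMarg-Fix : ∀ {x} → x ∈ L i → ∀ τ → condMarg I (Fix? I i x) i τ ≡ uniform (Fixed₁? x) τ
    condMarg-Fix {x} x∈Li τ = trans (Pinned.marginal-pinned i x (λ σ → Proper? σ ×-dec Fix? I i x σ) (λ σ → proj₂) τ)
      (uniform-cong (λ τ → Proper? (insertAt τ i x) ×-dec Fix? I i x (insertAt τ i x)) (Fixed₁? x)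
                    (λ τ → Proper⇒Proper⁺ {insertAt τ i x} ∘ proj₁)
                    (λ τ P⁺ → Proper⁺⇒Proper {insertAt τ i x} (x∈L τ) P⁺ , VecP.insertAt-lookup τ i x) τ)
      where
      x∈L : ∀ τ → lookup (insertAt τ i x) i ∈ L i
      x∈L τ = subst (_∈ L i) (sym (VecP.insertAt-lookup τ i x)) x∈Li

    condMarg-Fix2 : ∀ {x} y → x ∈ L i → ∀ τ → condMarg I (Fix2? I i x j y) i τ ≡ uniform (Fixed₂? x y) τ
    condMarg-Fix2 {x} y x∈Li τ = trans (Pinned.marginal-pinned i x (λ σ → Proper? σ ×-dec Fix2? I i x j y σ) (λ σ → proj₁ ∘ proj₂) τ)
      (uniform-cong (λ τ → Proper? (insertAt τ i x) ×-dec Fix2? I i x j y (insertAt τ i x)) (Fixed₂? x y)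
                    (λ τ (P , _ , j↦y) → Proper⇒Proper⁺ {insertAt τ i x} P , trans (sym (lookup-j τ x)) j↦y)
                    (λ τ (P⁺ , j′↦y) → Proper⁺⇒Proper {insertAt τ i x} (x∈L τ) P⁺ , VecP.insertAt-lookup τ i x , trans (lookup-j τ x) j′↦y) τ)
      where
      x∈L : ∀ τ → lookup (insertAt τ i x) i ∈ L i
      x∈L τ = subst (_∈ L i) (sym (VecP.insertAt-lookup τ i x)) x∈Li

    uniform-Fixed₂ : ∀ x y τ → uniform (Fixed₂? x y) τ ≡ fixAt j′ y (uniform (Rest? x y)) τ
    uniform-Fixed₂ x y τ = trans (uniform-pinned τ)
      (cong (when (lookup τ j′ ≟ y)) (uniform-cong Q?-at (Rest? x y) (λ ρ → proj₁) (λ ρ P⁺ → P⁺ , VecP.insertAt-lookup ρ j′ y) _))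
      where open Pinned j′ y (Fixed₂? x y) (λ τ → proj₂)

    adj-i⇒v : ∀ {e} → Adj i e → Inc e v
    adj-i⇒v {e} adj with adj⇒meet adj
    ... | z , i∋z , e∋z with i-endpoints i∋z
    ...   | inj₁ refl = ⊥-elim (proj₁ adj (sym (edge-at-u≡i e e∋z)))
    ...   | inj₂ refl = e∋z

    lookup-insertAt-≢ : ∀ (τ : Vec (Fin q) (suc m)) c x {e} → e ≢ i →
                        lookup (insertAt τ i c) e ≡ lookup (insertAt τ i x) e
    lookup-insertAt-≢ τ c x e≢i = begin
        lookup (insertAt τ i c) _
      ≡⟨ cong (lookup (insertAt τ i c)) (sym (FP.punchIn-punchOut (e≢i ∘ sym))) ⟩
        lookup (insertAt τ i c) (punchIn i (punchOut (e≢i ∘ sym)))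
      ≡⟨ trans (VecP.insertAt-punchIn τ i c _) (sym (VecP.insertAt-punchIn τ i x _)) ⟩
        lookup (insertAt τ i x) (punchIn i (punchOut (e≢i ∘ sym)))
      ≡⟨ cong (lookup (insertAt τ i x)) (FP.punchIn-punchOut (e≢i ∘ sym)) ⟩
        lookup (insertAt τ i x) _
      ∎
      where open ≡-Reasoning

    Avoiding : Fin q → Fin q → Vec (Fin q) (suc m) → Set
    Avoiding x c τ = Proper (insertAt τ i x) × FixAvoid I i x v c (insertAt τ i x)

    recolour-i : ∀ {x c} τ → c ∈ L i → Avoiding x c τ → Avoiding c x τ
    recolour-i {x} {c} τ c∈Li ((in-lists , distinct) , _ , avoids-c) =
      (in-lists′ , distinct′) , VecP.insertAt-lookup τ i c , avoids-x
      where
      τc τx : Vec (Fin q) (suc (suc m))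
      τc = insertAt τ i c
      τx = insertAt τ i x
      off-i : ∀ {e} → e ≢ i → lookup τc e ≡ lookup τx e
      off-i = lookup-insertAt-≢ τ c x
      c≢at : ∀ {e} → Adj i e → c ≢ lookup τc e
      c≢at {e} adj c≡ = avoids-c e (adj-i⇒v adj) (proj₁ adj ∘ sym) (trans (sym (off-i (proj₁ adj ∘ sym))) (sym c≡))
      in-lists′ : ∀ e → lookup τc e ∈ L e
      in-lists′ e with e ≟ i
      ... | yes refl = subst (_∈ L i) (sym (VecP.insertAt-lookup τ i c)) c∈Li
      ... | no e≢i   = subst (_∈ L e) (sym (off-i e≢i)) (in-lists e)
      distinct′ : ∀ e f → Adj e f → lookup τc e ≢ lookup τc f
      distinct′ e f adj with e ≟ i | f ≟ i
      ... | yes refl | yes refl = ⊥-elim (proj₁ adj refl)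
      ... | yes refl | no _     = c≢at adj ∘ trans (sym (VecP.insertAt-lookup τ i c))
      ... | no _     | yes refl = c≢at (adj-sym adj) ∘ trans (sym (VecP.insertAt-lookup τ i c)) ∘ sym
      ... | no e≢i   | no f≢i   = λ eq → distinct e f adj (trans (sym (off-i e≢i)) (trans eq (off-i f≢i)))
      avoids-x : ∀ e → Inc e v → e ≢ i → lookup τc e ≢ x
      avoids-x e e∋v e≢i eq = distinct i e (meet⇒adj (e≢i ∘ sym) (v , i∋v , e∋v))
                                         (trans (VecP.insertAt-lookup τ i x) (trans (sym eq) (off-i e≢i)))

    Avoiding? : ∀ x c τ → Dec (Avoiding x c τ)
    Avoiding? x c τ = Proper? (insertAt τ i x) ×-dec FixAvoid? I i x v c (insertAt τ i x)

    condMarg-FixAvoid : ∀ x c τ → condMarg I (FixAvoid? I i x v c) i τ ≡ uniform (Avoiding? x c) τ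
    condMarg-FixAvoid x c =
      Pinned.marginal-pinned i x (λ σ → Proper? σ ×-dec FixAvoid? I i x v c σ) (λ σ → proj₁ ∘ proj₂)

    W1≤-FixAvoid : ∀ {a b} → a ∈ L i → b ∈ L i →
                   W1≤ (condMarg I (FixAvoid? I i a v b) i) (condMarg I (FixAvoid? I i b v a) i) 0ℚ
    W1≤-FixAvoid {a} {b} a∈Li b∈Li = W1≤-cong (sym ∘ condMarg-FixAvoid a b) same-law
                                              (W1≤-refl _ (0≤uniform (Avoiding? a b)))
      where
      same-law : ∀ τ → uniform (Avoiding? a b) τ ≡ condMarg I (FixAvoid? I i b v a) i τ
      same-law τ = trans (uniform-cong (Avoiding? a b) (Avoiding? b a) (λ τ → recolour-i τ b∈Li) (λ τ → recolour-i τ a∈Li) τ)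
                         (sym (condMarg-FixAvoid b a τ))

    module Reduced (e₀ : Fin nV × Fin nV) (loopless₀ : proj₁ e₀ ≢ proj₂ e₀)
                   (separated : ∀ k → Inc (rest k) (proj₁ e₀) → Inc (rest k) (proj₂ e₀) → ⊥)
                   (L₀ : Subset q) (Lrest : Fin m → Subset q) where

      endsH : Fin (suc m) → Fin nV × Fin nV
      endsH zero    = e₀
      endsH (suc k) = ends (rest k)

      looplessH : ∀ e → proj₁ (endsH e) ≢ proj₂ (endsH e)
      looplessH zero    = loopless₀
      looplessH (suc k) = loopless (rest k)

      meets-both : ∀ l → Incident endsH zero (proj₁ (ends (rest l))) → Incident endsH zero (proj₂ (ends (rest l))) →
                   Inc (rest l) (proj₁ e₀) × Inc (rest l) (proj₂ e₀)
      meets-both l (inj₁ a) (inj₁ b) = ⊥-elim (loopless (rest l) (trans a (sym b)))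
      meets-both l (inj₁ a) (inj₂ b) = inj₁ (sym a) , inj₂ (sym b)
      meets-both l (inj₂ a) (inj₁ b) = inj₂ (sym b) , inj₁ (sym a)
      meets-both l (inj₂ a) (inj₂ b) = ⊥-elim (loopless (rest l) (trans a (sym b)))

      simpleH : ∀ e f → Incident endsH e (proj₁ (endsH f)) → Incident endsH e (proj₂ (endsH f)) → e ≡ f
      simpleH zero    zero    _ _ = refl
      simpleH (suc k) (suc l) a b = cong suc (rest-injective (simple (rest k) (rest l) a b))
      simpleH (suc k) zero    a b = ⊥-elim (separated k a b)
      simpleH zero    (suc l) a b = ⊥-elim (separated l (proj₁ (meets-both l a b)) (proj₂ (meets-both l a b)))

      H : Graph
      H = record { nV = nV ; nE = suc m ; ends = endsH ; loopless = looplessH ; simple = simpleH }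

      LH : Fin (suc m) → Subset q
      LH zero    = L₀
      LH (suc k) = Lrest k

      J : Instance
      J = record { G = H ; q = q ; L = LH }

      module J = Instance J

      Meets₀ : Fin m → Set
      Meets₀ k = Inc (rest k) (proj₁ e₀) ⊎ Inc (rest k) (proj₂ e₀)

      record ProperJ (z : Fin q) (ρ : Vec (Fin q) m) : Set where
        field
          z∈L₀     : z ∈ L₀
          ρ∈L      : ∀ k → lookup ρ k ∈ Lrest k
          z≢ρ      : ∀ k → Meets₀ k → z ≢ lookup ρ k
          ρ-proper : ∀ k l → Adj (rest k) (rest l) → lookup ρ k ≢ lookup ρ l

      adj₀⇒Meets₀ : ∀ k → J.Adj (suc k) zero → Meets₀ k
      adj₀⇒Meets₀ k (_ , inj₁ (inj₁ eq)) = inj₁ (inj₁ (sym eq))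
      adj₀⇒Meets₀ k (_ , inj₁ (inj₂ eq)) = inj₂ (inj₁ (sym eq))
      adj₀⇒Meets₀ k (_ , inj₂ (inj₁ eq)) = inj₁ (inj₂ (sym eq))
      adj₀⇒Meets₀ k (_ , inj₂ (inj₂ eq)) = inj₂ (inj₂ (sym eq))

      adj-suc⇒adj-rest : ∀ {k l} → J.Adj (suc k) (suc l) → Adj (rest k) (rest l)
      adj-suc⇒adj-rest (k≢l , meet) = (λ eq → k≢l (cong suc (rest-injective eq))) , meet

      adj-rest⇒adj-suc : ∀ {k l} → Adj (rest k) (rest l) → J.Adj (suc k) (suc l)
      adj-rest⇒adj-suc (k≢l , meet) = (λ eq → k≢l (cong rest (FP.suc-injective eq))) , meet

      Proper⇒ProperJ : ∀ {z ρ} → J.Proper (z ∷ ρ) → ProperJ z ρ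
      Proper⇒ProperJ (in-lists , distinct) = record
        { z∈L₀     = in-lists zero
        ; ρ∈L      = in-lists ∘ suc
        ; z≢ρ      = λ k meets → distinct zero (suc k) ((λ ()) , meets)
        ; ρ-proper = λ k l adj → distinct (suc k) (suc l) (adj-rest⇒adj-suc adj)
        }

      ProperJ⇒Proper : ∀ {z ρ} → ProperJ z ρ → J.Proper (z ∷ ρ)
      ProperJ⇒Proper {z} {ρ} P = in-lists , distinct
        where
        open ProperJ P
        in-lists : ∀ e → lookup (z ∷ ρ) e ∈ LH e
        in-lists zero    = z∈L₀
        in-lists (suc k) = ρ∈L k
        distinct : ∀ e f → J.Adj e f → lookup (z ∷ ρ) e ≢ lookup (z ∷ ρ) f
        distinct zero    zero    adj = ⊥-elim (proj₁ adj refl)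
        distinct zero    (suc l) adj = z≢ρ l (proj₂ adj)
        distinct (suc k) zero    adj = z≢ρ k (adj₀⇒Meets₀ k adj) ∘ sym
        distinct (suc k) (suc l) adj = ρ-proper k l (adj-suc⇒adj-rest adj)

      vdegJ : ∀ x → J.vdeg x ≡ 𝟙 (J.Inc? zero x) ℕ.+ count (λ k → Inc? (rest k) x)
      vdegJ x = length-filter-tabulate (λ e → J.Inc? e x) (suc m) (λ e → e)

      MaxDegLe-J : ∀ {Δ} → MaxDegLe Δ → (∀ x → J.Inc zero x → Inc i x ⊎ Inc j x) → J.MaxDegLe Δ
      MaxDegLe-J {Δ} maxdeg e₀⊆i∪j x = begin
          J.vdeg x
        ≡⟨ vdegJ x ⟩
          𝟙 (J.Inc? zero x) ℕ.+ count (λ k → Inc? (rest k) x)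
        ≤⟨ ℕP.+-monoˡ-≤ _ 𝟙₀≤𝟙ᵢ+𝟙ⱼ ⟩
          (𝟙 (Inc? i x) ℕ.+ 𝟙 (Inc? j x)) ℕ.+ count (λ k → Inc? (rest k) x)
        ≡⟨ ℕP.+-assoc (𝟙 (Inc? i x)) _ _ ⟩
          𝟙 (Inc? i x) ℕ.+ (𝟙 (Inc? j x) ℕ.+ count (λ k → Inc? (rest k) x))
        ≡⟨ sym (vdeg-split x) ⟩
          vdeg x
        ≤⟨ maxdeg x ⟩
          Δ
        ∎
        where
        open ℕP.≤-Reasoning
        𝟙₀≤𝟙ᵢ+𝟙ⱼ : 𝟙 (J.Inc? zero x) ≤ 𝟙 (Inc? i x) ℕ.+ 𝟙 (Inc? j x)
        𝟙₀≤𝟙ᵢ+𝟙ⱼ = 𝟙-⊎ (J.Inc? zero x) (Inc? i x) (Inc? j x) (e₀⊆i∪j x)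

      edegJ-zero : J.edeg zero ≡ count (λ k → J.Adj? zero (suc k))
      edegJ-zero = trans (length-filter-tabulate (J.Adj? zero) (suc m) (λ f → f))
                         (cong (ℕ._+ count (λ k → J.Adj? zero (suc k))) (𝟙-no (J.Adj? zero zero) (λ adj → proj₁ adj refl)))

      edegJ-suc : ∀ k → J.edeg (suc k) ≡ 𝟙 (J.Adj? (suc k) zero) ℕ.+ count (λ l → Adj? (rest k) (rest l))
      edegJ-suc k = trans (length-filter-tabulate (J.Adj? (suc k)) (suc m) (λ f → f))
        (cong (𝟙 (J.Adj? (suc k) zero) ℕ.+_)
              (count-cong (λ l → J.Adj? (suc k) (suc l)) (λ l → Adj? (rest k) (rest l))
                          (λ l → adj-suc⇒adj-rest) (λ l → adj-rest⇒adj-suc)))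

      edegJ-suc≤ : ∀ k → (J.Adj (suc k) zero → Adj (rest k) i ⊎ Adj (rest k) j) → J.edeg (suc k) ≤ edeg (rest k)
      edegJ-suc≤ k adj₀⇒adj = begin
          J.edeg (suc k)
        ≡⟨ edegJ-suc k ⟩
          𝟙 (J.Adj? (suc k) zero) ℕ.+ count (λ l → Adj? (rest k) (rest l))
        ≤⟨ ℕP.+-monoˡ-≤ _ (𝟙-⊎ (J.Adj? (suc k) zero) (Adj? (rest k) i) (Adj? (rest k) j) adj₀⇒adj) ⟩
          (𝟙 (Adj? (rest k) i) ℕ.+ 𝟙 (Adj? (rest k) j)) ℕ.+ count (λ l → Adj? (rest k) (rest l))
        ≡⟨ trans (ℕP.+-assoc (𝟙 (Adj? (rest k) i)) _ _) (sym (edeg-split (rest k))) ⟩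
          edeg (rest k)
        ∎
        where open ℕP.≤-Reasoning

      edegJ-zero≤ : ∀ e′ → (∀ k → J.Adj zero (suc k) → Adj e′ (rest k)) → J.edeg zero ≤ edeg e′
      edegJ-zero≤ e′ adj₀⇒adj = begin
          J.edeg zero
        ≡⟨ edegJ-zero ⟩
          count (λ k → J.Adj? zero (suc k))
        ≤⟨ count-mono (λ k → J.Adj? zero (suc k)) (λ k → Adj? e′ (rest k)) adj₀⇒adj ⟩
          count (λ l → Adj? e′ (rest l))
        ≤⟨ ℕP.m≤n+m _ (𝟙 (Adj? e′ i) ℕ.+ 𝟙 (Adj? e′ j)) ⟩
          𝟙 (Adj? e′ i) ℕ.+ 𝟙 (Adj? e′ j) ℕ.+ count (λ l → Adj? e′ (rest l))
        ≡⟨ trans (ℕP.+-assoc (𝟙 (Adj? e′ i)) _ _) (sym (edeg-split e′)) ⟩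
          edeg e′
        ∎
        where open ℕP.≤-Reasoning

      ListCond-J : ∀ {λ′ Δ} → (∀ e → Σ (Fin (suc (suc m))) λ e′ → J.edeg e ℕ.+ ∣ L e′ ∣ ≤ edeg e′ ℕ.+ ∣ LH e ∣) →
                   ListCond I λ′ Δ → ListCond J λ′ Δ
      ListCond-J {λ′} {Δ} dominated cond e =
        ListCond-transfer {e₁ = edeg e′} {l₁ = ∣ L e′ ∣} {e₂ = J.edeg e} {l₂ = ∣ LH e ∣} {X = λ′ ℚ.* ⟦ Δ ⟧}
                          (cond e′) (proj₂ (dominated e))
        where
        e′ : Fin (suc (suc m))
        e′ = proj₁ (dominated e)

      pendant₀ : ∀ z → Incident endsH zero z → (∀ k → ¬ Inc (rest k) z) → J.vdeg z ≡ 1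
      pendant₀ z e₀∋z rest∌z = trans (vdegJ z) (cong₂ ℕ._+_ (𝟙-yes (J.Inc? zero z) e₀∋z)
                                                            (count-none (λ k → Inc? (rest k) z) rest∌z))

      law-of-rest : ∀ {z x′ y′} → (∀ {ρ} → Compatible x′ y′ ρ → ProperJ z ρ) → (∀ {ρ} → ProperJ z ρ → Compatible x′ y′ ρ) →
                    ∀ ρ → condMarg J (Fix? J zero z) zero ρ ≡ uniform (Rest? x′ y′) ρ
      law-of-rest {z} {x′} {y′} Compatible⇒ProperJ ProperJ⇒Compatible ρ =
        trans (Pinned.marginal-pinned zero z (λ σ → J.Proper? σ ×-dec Fix? J zero z σ) (λ σ → proj₂) ρ)
              (uniform-cong (λ ρ → J.Proper? (z ∷ ρ) ×-dec (z ≟ z)) (Rest? x′ y′)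
                            (λ ρ → Compatible⇒Proper⁺ ∘ ProperJ⇒Compatible ∘ Proper⇒ProperJ ∘ proj₁)
                            (λ ρ P⁺ → ProperJ⇒Proper (Compatible⇒ProperJ (Proper⁺⇒Compatible P⁺)) , refl) ρ)

    -- j is replaced by the pendant edge uw with list L j, and the other edges at v lose x and y;
    -- colouring the new edge z then leaves exactly the choices compatible with i ← z′, j ← z for {z , z′} = {x , y}.
    module SwapReduction (x y : Fin q) (x≢y : x ≢ y) where

      Lrest : Fin m → Subset q
      Lrest k = if? Inc? (rest k) v then L (rest k) - x - y else L (rest k)

      open Reduced (u , w) u≢w (λ k rest∋u _ → rest-∌u k rest∋u) (L j) Lrest public

      MaxDegLe-swap : ∀ {Δ} → MaxDegLe Δ → J.MaxDegLe Δ
      MaxDegLe-swap maxdeg = MaxDegLe-J maxdeg e₀⊆i∪j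
        where
        e₀⊆i∪j : ∀ z → J.Inc zero z → Inc i z ⊎ Inc j z
        e₀⊆i∪j z (inj₁ refl) = inj₁ i∋u
        e₀⊆i∪j z (inj₂ refl) = inj₂ j∋w

      pendant-swap : J.Pendant zero
      pendant-swap = inj₁ (pendant₀ u (inj₁ refl) rest-∌u)

      Meets₀⇒AtJ : ∀ k → Meets₀ k → AtJ k
      Meets₀⇒AtJ k (inj₁ rest∋u) = ⊥-elim (rest-∌u k rest∋u)
      Meets₀⇒AtJ k (inj₂ rest∋w) = inj₂ rest∋w

      dominated-swap : ∀ e → Σ (Fin (suc (suc m))) λ e′ → J.edeg e ℕ.+ ∣ L e′ ∣ ≤ edeg e′ ℕ.+ ∣ LH e ∣
      dominated-swap zero    = j , exchange-≤ 0 (edegJ-zero≤ j (λ k adj → adj-j-rest k (Meets₀⇒AtJ k (proj₂ adj))))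
                                                  ℕP.≤-refl
      dominated-swap (suc k) = rest k , bound (Inc? (rest k) v)
        where
        C : ℕ
        C = count (λ l → Adj? (rest k) (rest l))
        bound : (d : Dec (Inc (rest k) v)) →
                J.edeg (suc k) ℕ.+ ∣ L (rest k) ∣ ≤ edeg (rest k) ℕ.+ ∣ if? d then L (rest k) - x - y else L (rest k) ∣
        bound (yes rest∋v) = exchange-≤ 2 (ℕP.≤-reflexive degrees)
          (ℕP.≤-trans (∣p∣≤1+∣p-x∣ (L (rest k)) x) (s≤s (∣p∣≤1+∣p-x∣ (L (rest k) - x) y)))
          where
          rest≁e₀ : ¬ J.Adj (suc k) zero
          rest≁e₀ adj with adj₀⇒Meets₀ k adj
          ... | inj₁ rest∋u = rest-∌u k rest∋u
          ... | inj₂ rest∋w = rest-∌v∧w k rest∋v rest∋w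
          degrees : 2 ℕ.+ J.edeg (suc k) ≡ edeg (rest k)
          degrees = begin
              2 ℕ.+ J.edeg (suc k)
            ≡⟨ cong (2 ℕ.+_) (trans (edegJ-suc k) (cong (ℕ._+ C) (𝟙-no (J.Adj? (suc k) zero) rest≁e₀))) ⟩
              1 ℕ.+ (1 ℕ.+ C)
            ≡⟨ sym (cong₂ (λ a b → a ℕ.+ (b ℕ.+ C)) (𝟙-yes (Adj? (rest k) i) (adj-sym (adj-i-rest k rest∋v)))
                                                      (𝟙-yes (Adj? (rest k) j) (adj-sym (adj-j-rest k (inj₁ rest∋v))))) ⟩
              𝟙 (Adj? (rest k) i) ℕ.+ (𝟙 (Adj? (rest k) j) ℕ.+ C)
            ≡⟨ sym (edeg-split (rest k)) ⟩
              edeg (rest k)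
            ∎
            where open ≡-Reasoning
        bound (no _) = exchange-≤ 0 (edegJ-suc≤ k (λ adj → inj₂ (adj-sym (adj-j-rest k (Meets₀⇒AtJ k (adj₀⇒Meets₀ k adj))))))
                                      ℕP.≤-refl

      SamePair : Fin q → Fin q → Set
      SamePair z z′ = (z ≡ x × z′ ≡ y) ⊎ (z ≡ y × z′ ≡ x)

      SamePair⇒≢ : ∀ {z z′} → SamePair z z′ → z′ ≢ z
      SamePair⇒≢ (inj₁ (refl , refl)) = x≢y ∘ sym
      SamePair⇒≢ (inj₂ (refl , refl)) = x≢y

      avoids-pair : ∀ {z z′ c} → SamePair z z′ → c ≢ z → c ≢ z′ → c ≢ x × c ≢ y
      avoids-pair (inj₁ (refl , refl)) c≢x c≢y = c≢x , c≢y
      avoids-pair (inj₂ (refl , refl)) c≢y c≢x = c≢x , c≢y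

      avoids-pair⁻¹ : ∀ {z z′ c} → SamePair z z′ → c ≢ x → c ≢ y → c ≢ z × c ≢ z′
      avoids-pair⁻¹ (inj₁ (refl , refl)) c≢x c≢y = c≢x , c≢y
      avoids-pair⁻¹ (inj₂ (refl , refl)) c≢x c≢y = c≢y , c≢x

      module Colours {z z′ : Fin q} (pair : SamePair z z′) where

        Compatible⇒ProperJ : ∀ {ρ} → Compatible z′ z ρ → ProperJ z ρ
        Compatible⇒ProperJ {ρ} C = record { z∈L₀ = y∈Lj ; ρ∈L = ρ∈Lrest ; z≢ρ = z≢ρ ; ρ-proper = ρ-proper }
          where
          open Compatible C
          ρ∈Lrest : ∀ k → lookup ρ k ∈ Lrest k
          ρ∈Lrest k with Inc? (rest k) v
          ... | yes rest∋v = let (ρ≢x , ρ≢y) = avoids-pair pair (y≢ρ k (inj₁ rest∋v) ∘ sym) (x≢ρ k rest∋v ∘ sym)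
                             in SP.x∈p∧x≢y⇒x∈p-y (SP.x∈p∧x≢y⇒x∈p-y (ρ∈L k) ρ≢x) ρ≢y
          ... | no _       = ρ∈L k
          z≢ρ : ∀ k → Meets₀ k → z ≢ lookup ρ k
          z≢ρ k meets = y≢ρ k (Meets₀⇒AtJ k meets)

        ProperJ⇒Compatible : ∀ {ρ} → ProperJ z ρ → Compatible z′ z ρ
        ProperJ⇒Compatible {ρ} P = record
          { y∈Lj = z∈L₀ ; ρ∈L = ρ∈L′ ; x≢y = SamePair⇒≢ pair ; x≢ρ = λ k rest∋v → proj₂ (avoids k rest∋v) ∘ sym
          ; y≢ρ = z≢ρ′ ; ρ-proper = ρ-proper }
          where
          open ProperJ P
          ρ∈L′ : ∀ k → lookup ρ k ∈ L (rest k)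
          ρ∈L′ k with Inc? (rest k) v | ρ∈L k
          ... | yes _ | ρk∈Lrest = x∈p-y⇒x∈p (x∈p-y⇒x∈p ρk∈Lrest)
          ... | no _  | ρk∈Lrest = ρk∈Lrest
          avoids : ∀ k → Inc (rest k) v → lookup ρ k ≢ z × lookup ρ k ≢ z′
          avoids k rest∋v with Inc? (rest k) v | ρ∈L k
          ... | yes _      | ρk∈Lrest = avoids-pair⁻¹ pair (x∈p-y⇒x≢y (x∈p-y⇒x∈p ρk∈Lrest)) (x∈p-y⇒x≢y ρk∈Lrest)
          ... | no rest∌v  | _        = ⊥-elim (rest∌v rest∋v)
          z≢ρ′ : ∀ k → AtJ k → z ≢ lookup ρ k
          z≢ρ′ k (inj₁ rest∋v) = proj₁ (avoids k rest∋v) ∘ sym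
          z≢ρ′ k (inj₂ rest∋w) = z≢ρ k (inj₂ rest∋w)

    -- j is deleted, i keeps its endpoints but gets an unrestricted list, and the neighbours of j lose y;
    -- colouring i with z then leaves exactly the choices compatible with i ← z, j ← y.
    module FixedJReduction (y : Fin q) (y∈Lj : y ∈ L j) where

      Lrest : Fin m → Subset q
      Lrest k = if? AtJ? k then L (rest k) - y else L (rest k)

      open Reduced (ends i) (loopless i) (λ k a b → rest≢i k (simple (rest k) i a b)) S.⊤ Lrest public

      MaxDegLe-fixed : ∀ {Δ} → MaxDegLe Δ → J.MaxDegLe Δ
      MaxDegLe-fixed maxdeg = MaxDegLe-J maxdeg (λ z i∋z → inj₁ i∋z)

      pendant-fixed : J.Pendant zero
      pendant-fixed = pendant-at i∋u (rest-∌u)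
        where
        pendant-at : ∀ {z} → Inc i z → (∀ k → ¬ Inc (rest k) z) → J.Pendant zero
        pendant-at (inj₁ refl) rest∌z = inj₁ (pendant₀ _ (inj₁ refl) rest∌z)
        pendant-at (inj₂ refl) rest∌z = inj₂ (pendant₀ _ (inj₂ refl) rest∌z)

      Meets₀⇒v : ∀ k → Meets₀ k → Inc (rest k) v
      Meets₀⇒v k (inj₁ rest∋z) = at-v k (inj₁ refl) rest∋z
      Meets₀⇒v k (inj₂ rest∋z) = at-v k (inj₂ refl) rest∋z

      v⇒Meets₀ : ∀ k → Inc (rest k) v → Meets₀ k
      v⇒Meets₀ k = meets i∋v
        where
        meets : ∀ {z} → Inc i z → Inc (rest k) z → Meets₀ k
        meets (inj₁ refl) rest∋z = inj₁ rest∋z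
        meets (inj₂ refl) rest∋z = inj₂ rest∋z

      dominated-fixed : ∀ e → Σ (Fin (suc (suc m))) λ e′ → J.edeg e ℕ.+ ∣ L e′ ∣ ≤ edeg e′ ℕ.+ ∣ LH e ∣
      dominated-fixed zero    = i , exchange-≤ 0 (edegJ-zero≤ i (λ k adj → (rest≢i k ∘ sym) , proj₂ adj))
                                                 (ℕP.≤-trans (SP.∣p∣≤n (L i)) (ℕP.≤-reflexive (sym (SP.∣⊤∣≡n q))))
      dominated-fixed (suc k) = rest k , bound (AtJ? k)
        where
        C : ℕ
        C = count (λ l → Adj? (rest k) (rest l))
        adj₀⇒adj-i : J.Adj (suc k) zero → Adj (rest k) i
        adj₀⇒adj-i adj = adj-sym (adj-i-rest k (Meets₀⇒v k (adj₀⇒Meets₀ k adj)))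
        bound : (d : Dec (AtJ k)) →
                J.edeg (suc k) ℕ.+ ∣ L (rest k) ∣ ≤ edeg (rest k) ℕ.+ ∣ if? d then L (rest k) - y else L (rest k) ∣
        bound (yes atJ) = exchange-≤ 1 degrees (∣p∣≤1+∣p-x∣ (L (rest k)) y)
          where
          degrees : 1 ℕ.+ J.edeg (suc k) ≤ edeg (rest k)
          degrees = begin
              1 ℕ.+ J.edeg (suc k)
            ≡⟨ cong (1 ℕ.+_) (edegJ-suc k) ⟩
              1 ℕ.+ (𝟙 (J.Adj? (suc k) zero) ℕ.+ C)
            ≡⟨ ℕ-+.x∙yz≈y∙xz 1 (𝟙 (J.Adj? (suc k) zero)) C ⟩
              𝟙 (J.Adj? (suc k) zero) ℕ.+ (1 ℕ.+ C)
            ≤⟨ ℕP.+-monoˡ-≤ (1 ℕ.+ C) (𝟙-mono (J.Adj? (suc k) zero) (Adj? (rest k) i) adj₀⇒adj-i) ⟩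
              𝟙 (Adj? (rest k) i) ℕ.+ (1 ℕ.+ C)
            ≡⟨ cong (λ b → 𝟙 (Adj? (rest k) i) ℕ.+ (b ℕ.+ C)) (sym (𝟙-yes (Adj? (rest k) j) (adj-sym (adj-j-rest k atJ)))) ⟩
              𝟙 (Adj? (rest k) i) ℕ.+ (𝟙 (Adj? (rest k) j) ℕ.+ C)
            ≡⟨ sym (edeg-split (rest k)) ⟩
              edeg (rest k)
            ∎
            where open ℕP.≤-Reasoning
        bound (no _) = exchange-≤ 0 (edegJ-suc≤ k (inj₁ ∘ adj₀⇒adj-i)) ℕP.≤-refl

      module Colours {z : Fin q} (z≢y : z ≢ y) where

        Compatible⇒ProperJ : ∀ {ρ} → Compatible z y ρ → ProperJ z ρ
        Compatible⇒ProperJ {ρ} C = record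
          { z∈L₀ = SP.∈⊤ ; ρ∈L = ρ∈Lrest ; z≢ρ = λ k meets → x≢ρ k (Meets₀⇒v k meets) ; ρ-proper = ρ-proper }
          where
          open Compatible C
          ρ∈Lrest : ∀ k → lookup ρ k ∈ Lrest k
          ρ∈Lrest k with AtJ? k
          ... | yes atJ = SP.x∈p∧x≢y⇒x∈p-y (ρ∈L k) (y≢ρ k atJ ∘ sym)
          ... | no _    = ρ∈L k

        ProperJ⇒Compatible : ∀ {ρ} → ProperJ z ρ → Compatible z y ρ
        ProperJ⇒Compatible {ρ} P = record
          { y∈Lj = y∈Lj ; ρ∈L = ρ∈L′ ; x≢y = z≢y ; x≢ρ = λ k rest∋v → z≢ρ k (v⇒Meets₀ k rest∋v)
          ; y≢ρ = y≢ρ ; ρ-proper = ρ-proper }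
          where
          open ProperJ P
          ρ∈L′ : ∀ k → lookup ρ k ∈ L (rest k)
          ρ∈L′ k with AtJ? k | ρ∈L k
          ... | yes _ | ρk∈Lrest = x∈p-y⇒x∈p ρk∈Lrest
          ... | no _  | ρk∈Lrest = ρk∈Lrest
          y≢ρ : ∀ k → AtJ k → y ≢ lookup ρ k
          y≢ρ k atJ with AtJ? k | ρ∈L k
          ... | yes _   | ρk∈Lrest = x∈p-y⇒x≢y ρk∈Lrest ∘ sym
          ... | no ¬atJ | _        = ⊥-elim (¬atJ atJ)

    module Distances {Δ : ℕ} {λ′ : ℚ} {s : ℕ} (maxdeg : MaxDegLe Δ) (edges≤s : suc (suc m) ≤ s)
                     (cond : ListCond I λ′ Δ) (K : ℚ) (κ≤K : KappaBound (s ∸ 1) Δ λ′ K) where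

      edges≤s∸1 : suc m ≤ s ∸ 1
      edges≤s∸1 = ℕP.∸-monoˡ-≤ 1 edges≤s

      module Swap {x y : Fin q} (x≢y : x ≢ y) (x∈Lj : x ∈ L j) (y∈Lj : y ∈ L j) where
        open SwapReduction x y x≢y

        law : ∀ {z z′} → SamePair z z′ → ∀ ρ → condMarg J (Fix? J zero z) zero ρ ≡ uniform (Rest? z′ z) ρ
        law pair = law-of-rest Compatible⇒ProperJ ProperJ⇒Compatible
          where open Colours pair

        W1≤-Rest : W1≤ (uniform (Rest? x y)) (uniform (Rest? y x)) K
        W1≤-Rest = W1≤-cong (law (inj₂ (refl , refl))) (law (inj₁ (refl , refl)))
          (κ≤K J edges≤s∸1 (MaxDegLe-swap maxdeg) (ListCond-J {λ′} {Δ} dominated-swap cond) zero pendant-swap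
               y x y∈Lj x∈Lj (x≢y ∘ sym))

        W1≤-Fixed₂ : W1≤ (uniform (Fixed₂? x y)) (uniform (Fixed₂? y x)) (1ℚ + K)
        W1≤-Fixed₂ = W1≤-cong (sym ∘ uniform-Fixed₂ x y) (sym ∘ uniform-Fixed₂ y x)
          (subst (λ h → W1≤ (fixAt j′ y (uniform (Rest? x y))) (fixAt j′ x (uniform (Rest? y x))) (⟦ h ⟧ + K))
                 (ham₁≡1 (x≢y ∘ sym))
                 (W1≤-fixAt j′ y x (∑-uniform≤1 (Rest? x y)) W1≤-Rest))

      module Fixed {x z y : Fin q} (x≢y : x ≢ y) (z≢y : z ≢ y) (x≢z : x ≢ z) (y∈Lj : y ∈ L j) where
        open FixedJReduction y y∈Lj

        law : ∀ {c} → c ≢ y → ∀ ρ → condMarg J (Fix? J zero c) zero ρ ≡ uniform (Rest? c y) ρ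
        law c≢y = law-of-rest Compatible⇒ProperJ ProperJ⇒Compatible
          where open Colours c≢y

        W1≤-Rest : W1≤ (uniform (Rest? x y)) (uniform (Rest? z y)) K
        W1≤-Rest = W1≤-cong (law x≢y) (law z≢y)
          (κ≤K J edges≤s∸1 (MaxDegLe-fixed maxdeg) (ListCond-J {λ′} {Δ} dominated-fixed cond) zero pendant-fixed
               x z SP.∈⊤ SP.∈⊤ x≢z)

        W1≤-Fixed₂ : W1≤ (uniform (Fixed₂? x y)) (uniform (Fixed₂? z y)) K
        W1≤-Fixed₂ = W1≤-cong (sym ∘ uniform-Fixed₂ x y) (sym ∘ uniform-Fixed₂ z y)
          (W1≤-mono (ℚP.≤-reflexive (trans (cong (λ h → ⟦ h ⟧ + K) (ham-refl (y ∷ []))) (ℚP.+-identityˡ K)))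
                    (W1≤-fixAt j′ y y (∑-uniform≤1 (Rest? x y)) W1≤-Rest))

      W1≤-Fix2-swap : ∀ {a b} → a ≢ b → a ∈ L i → b ∈ L i → a ∈ L j → b ∈ L j →
                      W1≤ (condMarg I (Fix2? I i a j b) i) (condMarg I (Fix2? I i b j a) i) (1ℚ + K)
      W1≤-Fix2-swap {a} {b} a≢b a∈Li b∈Li a∈Lj b∈Lj =
        W1≤-cong (sym ∘ condMarg-Fix2 b a∈Li) (sym ∘ condMarg-Fix2 a b∈Li) (Swap.W1≤-Fixed₂ a≢b a∈Lj b∈Lj)

      module UnfixJ {x y : Fin q} (x≢y : x ≢ y) (x∈Lj : x ∈ L j) (y∈Lj : y ∈ L j) where
        open ℚP.≤-Reasoning

        0≤K : 0ℚ ℚ.≤ K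
        0≤K = W1≤⇒0≤r (Swap.W1≤-Rest x≢y x∈Lj y∈Lj)

        ⟦2⟧*K≡K+K : ⟦ 2 ⟧ * K ≡ K + K
        ⟦2⟧*K≡K+K = trans (cong (_* K) (⟦⟧-+ 1 1))
                          (trans (ℚP.*-distribʳ-+ K 1ℚ 1ℚ) (cong₂ _+_ (ℚP.*-identityˡ K) (ℚP.*-identityˡ K)))

        1+K≤1+2K : 1ℚ + K ℚ.≤ 1ℚ + ⟦ 2 ⟧ * K
        1+K≤1+2K = ℚP.+-monoʳ-≤ 1ℚ (begin
            K           ≡⟨ sym (ℚP.+-identityʳ K) ⟩
            K + 0ℚ      ≤⟨ ℚP.+-monoʳ-≤ K 0≤K ⟩
            K + K       ≡⟨ sym ⟦2⟧*K≡K+K ⟩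
            ⟦ 2 ⟧ * K   ∎)

        K+[1+K]≡1+2K : K + (1ℚ + K) ≡ 1ℚ + ⟦ 2 ⟧ * K
        K+[1+K]≡1+2K = trans (sym (ℚP.+-assoc K 1ℚ K)) (trans (cong (_+ K) (ℚP.+-comm K 1ℚ))
                             (trans (ℚP.+-assoc 1ℚ K K) (cong (1ℚ +_) (sym ⟦2⟧*K≡K+K))))

        -- Since couplings preserve mass, a colouring with i ← x, j ← y would give one with i ← y, j ← x.
        no-rest-colourings : size (suc m) (Fixed₁? y) ≡ 0 → size m (Rest? x y) ≡ 0
        no-rest-colourings size≡0 with size m (Rest? x y) ℕ.≟ 0
        ... | yes xy≡0 = xy≡0
        ... | no xy≢0  = ⊥-elim (witness⇒size≢0 (Fixed₁? y) (insertAt (proj₁ witness) j′ x) (proj₂ witness) size≡0)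
          where
          mass : ∑V m (uniform (Rest? y x)) ≡ 1ℚ
          mass = trans (sym (W1≤⇒∑≡ (Swap.W1≤-Rest x≢y x∈Lj y∈Lj))) (∑-uniform≡1 (Rest? x y) xy≢0)
          yx≢0 : size m (Rest? y x) ≢ 0
          yx≢0 yx≡0 = ℚP.1≢0 (trans (sym mass) (∑-uniform-empty (Rest? y x) yx≡0))
          witness : Σ (Vec (Fin q) m) (λ ρ → Proper⁺ (assemble y x ρ))
          witness = size≢0⇒witness (Rest? y x) yx≢0

        W1≤-via-j↦c : ∀ {c} → Σ (Vec (Fin q) (suc m)) (λ τ → Proper⁺ (insertAt τ i y) × lookup τ j′ ≡ c) →
                      W1≤ (uniform (Fixed₂? x y)) (uniform (Fixed₂? y c)) (1ℚ + ⟦ 2 ⟧ * K)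
        W1≤-via-j↦c {c} (τ , P⁺ , τj′≡c) = by-colour (c ≟ x)
          where
          τ≡ : insertAt (removeAt τ j′) j′ c ≡ τ
          τ≡ = trans (cong (insertAt (removeAt τ j′) j′) (sym τj′≡c)) (VecP.insertAt-removeAt τ j′)
          C : Compatible y c (removeAt τ j′)
          C = Proper⁺⇒Compatible (subst (λ t → Proper⁺ (insertAt t i y)) (sym τ≡) P⁺)
          y≢c : y ≢ c
          y≢c = Compatible.x≢y C
          by-colour : Dec (c ≡ x) → W1≤ (uniform (Fixed₂? x y)) (uniform (Fixed₂? y c)) (1ℚ + ⟦ 2 ⟧ * K)
          by-colour (yes refl) = W1≤-mono 1+K≤1+2K (Swap.W1≤-Fixed₂ x≢y x∈Lj y∈Lj)
          by-colour (no c≢x)   = W1≤-mono (ℚP.≤-reflexive K+[1+K]≡1+2K)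
            (W1≤-trans (Fixed.W1≤-Fixed₂ x≢y (y≢c ∘ sym) (c≢x ∘ sym) y∈Lj)
                       (Swap.W1≤-Fixed₂ (y≢c ∘ sym) (Compatible.y∈Lj C) y∈Lj))

        open ByValue (Fixed₁? y) (λ τ → lookup τ j′)

        component : ∀ c → (weight c ≡ 0ℚ) ⊎ W1≤ (uniform (Fixed₂? x y)) (uniform (Fixed₂? y c)) (1ℚ + ⟦ 2 ⟧ * K)
        component c = by-size (size (suc m) (Fixed₂? y c) ℕ.≟ 0)
          where
          by-size : Dec (size (suc m) (Fixed₂? y c) ≡ 0) →
                    (weight c ≡ 0ℚ) ⊎ W1≤ (uniform (Fixed₂? x y)) (uniform (Fixed₂? y c)) (1ℚ + ⟦ 2 ⟧ * K)
          by-size (yes size≡0) = inj₁ (weight≡0 c size≡0)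
          by-size (no size≢0)  = inj₂ (W1≤-via-j↦c (size≢0⇒witness (Fixed₂? y c) size≢0))

        W1≤-Fixed₂-Fixed₁ : W1≤ (uniform (Fixed₂? x y)) (uniform (Fixed₁? y)) (1ℚ + ⟦ 2 ⟧ * K)
        W1≤-Fixed₂-Fixed₁ = by-size (size (suc m) (Fixed₁? y) ℕ.≟ 0)
          where
          0≤1+2K : 0ℚ ℚ.≤ 1ℚ + ⟦ 2 ⟧ * K
          0≤1+2K = ℚP.≤-trans (W1≤⇒0≤r (Swap.W1≤-Fixed₂ x≢y x∈Lj y∈Lj)) 1+K≤1+2K
          vanishes : size (suc m) (Fixed₁? y) ≡ 0 → ∀ τ → uniform (Fixed₂? x y) τ ≡ 0ℚ
          vanishes size≡0 τ = trans (uniform-Fixed₂ x y τ)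
            (trans (cong (when (lookup τ j′ ≟ y)) (uniform-empty (Rest? x y) (no-rest-colourings size≡0) (removeAt τ j′)))
                   (when-zero (lookup τ j′ ≟ y)))
          by-size : Dec (size (suc m) (Fixed₁? y) ≡ 0) →
                    W1≤ (uniform (Fixed₂? x y)) (uniform (Fixed₁? y)) (1ℚ + ⟦ 2 ⟧ * K)
          by-size (yes size≡0) = W1≤-cong (sym ∘ vanishes size≡0) (sym ∘ uniform-empty (Fixed₁? y) size≡0)
                                          (W1≤-mono 0≤1+2K W1≤-zero)
          by-size (no size≢0)  = W1≤-mixture (allFin q) weight (λ c → uniform (Fixed₂? y c)) 0≤weight (∑-weight size≢0)
                                             uniform≡mixture component

      W1≤-Fix2-Fix : ∀ {x y} → x ≢ y → x ∈ L i → y ∈ L i → x ∈ L j → y ∈ L j →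
                     W1≤ (condMarg I (Fix2? I i x j y) i) (condMarg I (Fix? I i y) i) (1ℚ + ⟦ 2 ⟧ * K)
      W1≤-Fix2-Fix {x} {y} x≢y x∈Li y∈Li x∈Lj y∈Lj =
        W1≤-cong (sym ∘ condMarg-Fix2 y x∈Li) (sym ∘ condMarg-Fix y∈Li) (UnfixJ.W1≤-Fixed₂-Fixed₁ x≢y x∈Lj y∈Lj)

open import Data.Nat using (_≤_)

lemma4p6 : (Δ : ℕ) (λ' : ℚ) (s : ℕ) → 1 ≤ Δ → 0ℚ ℚ.< λ' → 2 ≤ s →
    (I : Instance) → let open Instance I in
    MaxDegLe Δ → nE ≤ s → ListCond I λ' Δ →
    (i : Fin nE) (u v : Fin nV) → Inc i u → Inc i v → u ≢ v →
    vdeg u ≡ 1 → 2 ≤ vdeg v →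
    (a b : Fin q) → a ∈ L i → b ∈ L i → a ≢ b →
    (j : Fin nE) → Inc j v → j ≢ i → a ∈ L j → b ∈ L j →
    ((K : ℚ) → KappaBound (s ∸ 1) Δ λ' K →
       W1≤ (condMarg I (Fix2? I i a j b) i) (condMarg I (Fix2? I i b j a) i) (1ℚ ℚ.+ K))
    × ((K : ℚ) → KappaBound (s ∸ 1) Δ λ' K →
       W1≤ (condMarg I (Fix2? I i a j b) i) (condMarg I (Fix? I i b) i) (1ℚ ℚ.+ ⟦ 2 ⟧ ℚ.* K)
       × W1≤ (condMarg I (Fix2? I i b j a) i) (condMarg I (Fix? I i a) i) (1ℚ ℚ.+ ⟦ 2 ⟧ ℚ.* K))
    × W1≤ (condMarg I (FixAvoid? I i a v b) i) (condMarg I (FixAvoid? I i b v a) i) 0ℚ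
lemma4p6 _ _ _ _ _ _ record { G = record { nE = zero } } _ _ _ ()
lemma4p6 _ _ _ _ _ _ record { G = record { nE = suc zero } } _ _ _ zero _ _ _ _ _ _ _ _ _ _ _ _ zero _ j≢i _ _ =
  ⊥-elim (j≢i refl)
lemma4p6 Δ λ' s _ _ _ record { G = record { nE = suc (suc m) ; ends = ends ; loopless = loopless ; simple = simple } ; q = q ; L = L }
         maxdeg edges≤s cond i u v i∋u i∋v u≢v deg-u≡1 _ a b a∈Li b∈Li a≢b j j∋v j≢i a∈Lj b∈Lj =
    (λ K κ≤K → W1≤-Fix2-swap K κ≤K a≢b a∈Li b∈Li a∈Lj b∈Lj)
  , (λ K κ≤K → W1≤-Fix2-Fix K κ≤K a≢b a∈Li b∈Li a∈Lj b∈Lj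
             , W1≤-Fix2-Fix K κ≤K (a≢b ∘ sym) b∈Li a∈Li b∈Lj a∈Lj)
  , W1≤-FixAvoid a∈Li b∈Li
  where
  open Configuration.Pendant ends loopless simple q L i i∋u i∋v u≢v deg-u≡1 j j∋v j≢i
  open Distances {Δ} {λ'} {s} maxdeg edges≤s cond
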